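{- For $s\in\mu_r$, $u,v\in\mathcal{A}_1$ and $w\in\mathcal{A}_r$, \[ (u\diamond_1 v)\diamond_s w=u\diamond_s(v\diamond_s w). \]
   Context: Let $r\ge1$, $\mu_r$ the $r$-th roots of unity, $\mathcal{A}_r=\mathbb{Q}\langle x,y_s\mid s\in\mu_r\rangle$, $y=y_1$, $z=x+y_1$, $z_t=x+y_t$, $\delta(1)=0$, $\delta(s)=1$ for $s\ne1$, $z_{k,s}=x^{k-1}y_s$, $\mathcal{A}_1=\mathbb{Q}\langle x,y\rangle\subset\mathcal{A}_r$. $\varphi$: automorphism of $\mathcal{A}_r$ with $\varphi(x)=z$, $\varphi(y_s)=\delta(s)y_s-y_1$. $\mathcal{I}(z_{k_1,s_1}\cdots z_{k_l,s_l}x^a)=z_{k_1,s_1}z_{k_2,s_1s_2}\cdots z_{k_l,s_1\cdots s_l}x^a$, $M_s(z_{k_1,s_1}\cdots z_{k_l,s_l}x^a)=z_{k_1,ss_1}z_{k_2,s_2}\cdots z_{k_l,s_l}x^a$ (linear, $a\ge0$), $\psi_s=\varphi\mathcal{I}M_s$. Diamond product $\diamond_s:\mathcal{A}_1\times\mathcal{A}_r\to\mathcal{A}_r$ ($s\in\mu_r$): $\mathbb{Q}$-bilinear, defined recursively for words $v\in\mathcal{A}_1,w\in\mathcal{A}_r$, $1\ne t\in\mu_r$ by $1\diamond_s w=w$, $v\diamond_s1=\psi_s\varphi(v)$, $vx\diamond_s wx=(v\diamond_s wx)x-(vy\diamond_s w)x$, $vy\diamond_s wx=(v\diamond_s wx)y+(vy\diamond_s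 w)x$, $vx\diamond_s wy=(v\diamond_s wy)x+(vx\diamond_s w)y$, $vy\diamond_s wy=(v\diamond_s wy)y-(vx\diamond_s w)y$, $vx\diamond_s wy_t=(v\diamond_s wy_t)x+(v\diamond_s wz_t)y_t-(vy\diamond_s w)y_t$, $vy\diamond_s wy_t=(v\diamond_s wy_t)y-(v\diamond_s wz_t)y_t+(vy\diamond_s w)y_t$. (For $u,v\in\mathcal{A}_1$, $u\diamond_1v\in\mathcal{A}_1$.) -}

module Defs where

open import Data.Nat using (ℕ; zero; suc)
import Data.Nat as ℕ
open import Data.Nat.DivMod using (_mod_)
open import Data.Fin using (Fin; toℕ) renaming (zero to fzero)
import Data.Fin as F
open import Data.Rational using (ℚ; 0ℚ; 1ℚ; -_) renaming (_+_ to _+ℚ_; _*_ to _*ℚ_)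
open import Data.List using (List; []; _∷_; _++_; concatMap; map)
open import Data.Product using (_×_; _,_; proj₁; proj₂)
open import Data.Bool using (Bool; true; false; if_then_else_)
open import Data.Maybe using (Maybe; just; nothing)
open import Relation.Nullary using (Dec; yes; no; does)
open import Relation.Binary.PropositionalEquality using (_≡_; refl; cong; cong₂)

-- Roots of unity μ_r with r = suc n ≥ 1: the root e^{2πik/r} is encoded
-- by k : Fin r; the root 1 is fzero; multiplication of roots is addition
-- of exponents modulo r.

Root : ℕ → Set
Root n = Fin (suc n)

_⊙_ : {n : ℕ} → Root n → Root n → Root n
_⊙_ {n} i j = (toℕ i ℕ.+ toℕ j) mod (suc n)

one : {n : ℕ} → Root n
one = fzero

-- Letters and words of A_r (r = suc n): x and y_s, s ∈ μ_r.
-- Words are snoc-lists (the recursions act on the last letter).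

data Letter (n : ℕ) : Set where
  x : Letter n
  y : Root n → Letter n

data Word (n : ℕ) : Set where
  ε   : Word n
  _▷_ : Word n → Letter n → Word n

infixl 5 _▷_

_·w_ : {n : ℕ} → Word n → Word n → Word n
u ·w ε       = u
u ·w (w ▷ a) = (u ·w w) ▷ a

-- Letters and words of A_1 = ℚ⟨x , y⟩ (y = y_1).
data Letter₁ : Set where
  x₁ : Letter₁
  y₁ : Letter₁

data Word₁ : Set where
  ε₁   : Word₁
  _▷₁_ : Word₁ → Letter₁ → Word₁

infixl 5 _▷₁_

ιL : {n : ℕ} → Letter₁ → Letter n
ιL x₁ = x
ιL y₁ = y one

ιW : {n : ℕ} → Word₁ → Word n
ιW ε₁       = ε
ιW (w ▷₁ a) = ιW w ▷ ιL a

_≟L_ : {n : ℕ} → (a b : Letter n) → Dec (a ≡ b)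
x ≟L x = yes refl
x ≟L y _ = no (λ ())
y _ ≟L x = no (λ ())
y s ≟L y t with s F.≟ t
... | yes refl = yes refl
... | no ¬p = no (λ { refl → ¬p refl })

_≟W_ : {n : ℕ} → (u w : Word n) → Dec (u ≡ w)
ε ≟W ε = yes refl
ε ≟W (_ ▷ _) = no (λ ())
(_ ▷ _) ≟W ε = no (λ ())
(u ▷ a) ≟W (w ▷ b) with u ≟W w | a ≟L b
... | yes refl | yes refl = yes refl
... | no ¬p | _ = no (λ { refl → ¬p refl })
... | _ | no ¬q = no (λ { refl → ¬q refl })

-- Elements of A_r (resp. A_1): finite ℚ-linear combinations of words,
-- represented as lists of (coefficient , word); two such are equal in
-- A_r iff every word has the same total coefficient (_≈_ below).

Poly : ℕ → Set
Poly n = List (ℚ × Word n)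

Poly₁ : Set
Poly₁ = List (ℚ × Word₁)

coeff : {n : ℕ} → Poly n → Word n → ℚ
coeff []             w = 0ℚ
coeff ((c , u) ∷ p) w = (if does (u ≟W w) then c else 0ℚ) +ℚ coeff p w

_≈_ : {n : ℕ} → Poly n → Poly n → Set
p ≈ q = ∀ w → coeff p w ≡ coeff q w

infix 4 _≈_

mon : {n : ℕ} → Word n → Poly n
mon w = (1ℚ , w) ∷ []

lit : {n : ℕ} → Letter n → Poly n
lit a = mon (ε ▷ a)

_⊕_ : {n : ℕ} → Poly n → Poly n → Poly n
p ⊕ q = p ++ q

_⊛_ : {n : ℕ} → ℚ → Poly n → Poly n
c ⊛ p = map (λ { (d , w) → (c *ℚ d , w) }) p

⊝_ : {n : ℕ} → Poly n → Poly n
⊝ p = (- 1ℚ) ⊛ p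

_⊖_ : {n : ℕ} → Poly n → Poly n → Poly n
p ⊖ q = p ⊕ (⊝ q)

infixl 6 _⊕_ _⊖_

_⊗_ : {n : ℕ} → Poly n → Poly n → Poly n
p ⊗ q = concatMap (λ { (c , u) → map (λ { (d , w) → (c *ℚ d , u ·w w) }) q }) p

infixl 7 _⊗_

_▶_ : {n : ℕ} → Poly n → Letter n → Poly n
p ▶ a = map (λ { (c , w) → (c , w ▷ a) }) p

infixl 7 _▶_

lin : {n m : ℕ} → (Word n → Poly m) → Poly n → Poly m
lin f p = concatMap (λ { (c , w) → c ⊛ f w }) p

lin₁ : {m : ℕ} → (Word₁ → Poly m) → Poly₁ → Poly m
lin₁ f p = concatMap (λ { (c , w) → c ⊛ f w }) p

ι : {n : ℕ} → Poly₁ → Poly n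
ι p = map (λ { (c , w) → (c , ιW w) }) p

toWord₁ : {n : ℕ} → Word n → Maybe Word₁
toWord₁ ε = just ε₁
toWord₁ (w ▷ x) with toWord₁ w
... | just u  = just (u ▷₁ x₁)
... | nothing = nothing
toWord₁ (w ▷ y (F.suc _)) = nothing
toWord₁ (w ▷ y fzero) with toWord₁ w
... | just u  = just (u ▷₁ y₁)
... | nothing = nothing

ρ : {n : ℕ} → Poly n → Poly₁
ρ [] = []
ρ ((c , w) ∷ p) with toWord₁ w
... | just u  = (c , u) ∷ ρ p
... | nothing = ρ p

isOne : {n : ℕ} → Root n → Bool
isOne fzero    = true
isOne (F.suc _) = false

φL : {n : ℕ} → Letter n → Poly n
φL x     = lit x ⊕ lit (y one)
φL (y s) = if isOne s then ⊝ lit (y one) else lit (y s) ⊖ lit (y one)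

φW : {n : ℕ} → Word n → Poly n
φW ε       = mon ε
φW (w ▷ a) = φW w ⊗ φL a

φ : {n : ℕ} → Poly n → Poly n
φ = lin φW

yprod : {n : ℕ} → Word n → Root n
yprod ε           = one
yprod (w ▷ x)     = yprod w
yprod (w ▷ y t)   = yprod w ⊙ t

𝓘W : {n : ℕ} → Word n → Word n
𝓘W ε         = ε
𝓘W (w ▷ x)   = 𝓘W w ▷ x
𝓘W (w ▷ y t) = 𝓘W w ▷ y (yprod w ⊙ t)

𝓘 : {n : ℕ} → Poly n → Poly n
𝓘 = lin (λ w → mon (𝓘W w))

-- M_s: the first y-letter y_{s_1} becomes y_{s s_1} (identity on x^a)
hasY : {n : ℕ} → Word n → Bool
hasY ε         = false
hasY (w ▷ x)   = hasY w
hasY (w ▷ y _) = true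

MW : {n : ℕ} → Root n → Word n → Word n
MW s ε         = ε
MW s (w ▷ x)   = MW s w ▷ x
MW s (w ▷ y t) = if hasY w then MW s w ▷ y t else w ▷ y (s ⊙ t)

M : {n : ℕ} → Root n → Poly n → Poly n
M s = lin (λ w → mon (MW s w))

ψ : {n : ℕ} → Root n → Poly n → Poly n
ψ s p = φ (𝓘 (M s p))

-- For a fixed word v, `step` computes the pair (vx ⋄_s w , vy ⋄_s w)
-- by recursion on w, given the already defined map v ⋄_s (-)
-- (extended linearly as Dv).

module _ {n : ℕ} (s : Root n) where

  base : Word₁ → Poly n
  base v = ψ s (φ (mon (ιW v)))

  step : (Poly n → Poly n) → Word₁ → Word n → Poly n × Poly n
  step Dv v ε = base (v ▷₁ x₁) , base (v ▷₁ y₁)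
  step Dv v (w ▷ x) =
    let Y = proj₂ (step Dv v w) in
    (Dv (mon (w ▷ x)) ▶ x ⊖ Y ▶ x) ,
    (Dv (mon (w ▷ x)) ▶ y one ⊕ Y ▶ x)
  step Dv v (w ▷ y t) with isOne t
  ... | true =
    let X = proj₁ (step Dv v w) in
    (Dv (mon (w ▷ y t)) ▶ x ⊕ X ▶ y one) ,
    (Dv (mon (w ▷ y t)) ▶ y one ⊖ X ▶ y one)
  ... | false =
    let Y  = proj₂ (step Dv v w)
        Dz = Dv (mon (w ▷ x) ⊕ mon (w ▷ y t)) in
    (Dv (mon (w ▷ y t)) ▶ x ⊕ Dz ▶ y t ⊖ Y ▶ y t) ,
    (Dv (mon (w ▷ y t)) ▶ y one ⊖ Dz ▶ y t ⊕ Y ▶ y t)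

  ⋄W : Word₁ → Word n → Poly n
  ⋄W ε₁ w = mon w
  ⋄W (v ▷₁ x₁) w = proj₁ (step (lin (⋄W v)) v w)
  ⋄W (v ▷₁ y₁) w = proj₂ (step (lin (⋄W v)) v w)

⋄ : {n : ℕ} → Root n → Poly₁ → Poly n → Poly n
⋄ s u w = lin₁ (λ v → lin (⋄W s v) w) u

⋄₁ : (n : ℕ) → Poly₁ → Poly₁ → Poly₁
⋄₁ n u v = ρ (⋄ {n} one u (ι v))

-- Both sides are bilinear, so it suffices to take u, v and w to be words. For a fixed w the
-- identity is proved by a double induction on u and v, both generated from 1 by right
-- multiplication with z = x + y and with y (x = z − y). The z-steps only use
-- (u z) ⋄_s w = (u ⋄_s w) z and u ⋄_s (w z) = (u ⋄_s w) z, which follow from the defining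
-- recursion, and base cases reduce to 1 ⋄_s w = w and u ⋄_s 1 = ψ_s φ(u): on A₁ the map
-- ψ_s φ is the algebra morphism φ σ_s φ, σ_s replacing y by y_s. Only the step (u y, v y)
-- depends on the last letter of w, and it is handled by an outer induction on w, written via
-- w' y, w' z_t (x = z − y, y_t = z_t − x) and 1. All the polynomial identities met on the way
-- are decided by expanding both sides into monomials.

module Submission where

open import Defs
open import Data.Nat using (ℕ; zero; suc; _≤_; z≤n; s≤s)
open import Data.Nat.DivMod using (_mod_; m<n⇒m%n≡m)
open import Data.Fin using (Fin; toℕ) renaming (zero to fzero; suc to fsuc)
import Data.Fin.Properties as Fin
import Data.Nat.Properties as ℕ
open import Data.Rational using (ℚ; 0ℚ; 1ℚ; -_) renaming (_+_ to _+ℚ_; _*_ to _*ℚ_)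
import Data.Rational.Properties as ℚ
open import Data.Rational.Solver using (module +-*-Solver)
open import Algebra.Properties.Group ℚ.+-0-group using (x∙y⁻¹≈ε⇒x≈y)
open import Data.List using (List; []; _∷_; _++_; map; length)
open import Data.List.Properties using () renaming (≡-dec to List-≡-dec)
open import Data.List.Relation.Unary.All using (All; all?; lookupWith)
open import Data.List.Relation.Unary.Any using (Any; here; there)
open import Data.List.Relation.Binary.Pointwise using (Pointwise; []; _∷_)
open import Data.Product using (_×_; _,_; proj₁; proj₂)
open import Data.Product.Properties using () renaming (≡-dec to ×-≡-dec)
open import Data.Sum using (_⊎_; inj₁; inj₂)
open import Data.Maybe using (just; nothing)
open import Data.Maybe.Properties using (just-injective)
open import Function using (case_of_)
open import Data.Bool using (true; false; if_then_else_)
open import Level using (0ℓ)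
open import Relation.Nullary using (Dec; yes; no; does)
open import Relation.Nullary.Decidable using (dec-true; dec-false; True; toWitness)
open import Relation.Binary using (Setoid; DecidableEquality)
import Relation.Binary.Reasoning.Setoid as SetoidReasoning
open import Relation.Binary.PropositionalEquality

open +-*-Solver using (solve; _:+_; _:*_; :-_; _:=_; con)

if-*ʳ : ∀ b (c d : ℚ) → (if b then c *ℚ d else 0ℚ) ≡ c *ℚ (if b then d else 0ℚ)
if-*ʳ true  c d = refl
if-*ʳ false c d = sym (ℚ.*-zeroʳ c)

-1*-neg : ∀ a → (- 1ℚ) *ℚ a ≡ - a
-1*-neg = solve 1 (λ a → con (- 1ℚ) :* a := :- a) refl

module FormalSums {K : Set} (_≟_ : DecidableEquality K) where

  Sum : Set
  Sum = List (ℚ × K)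

  coeffOf : Sum → K → ℚ
  coeffOf []            k = 0ℚ
  coeffOf ((c , u) ∷ p) k = (if does (u ≟ k) then c else 0ℚ) +ℚ coeffOf p k

  -- A record rather than a function type, so that p and q can be inferred from a proof.
  infix 4 _≃_
  record _≃_ (p q : Sum) : Set where
    constructor coeffwise
    field at : ∀ k → coeffOf p k ≡ coeffOf q k
  open _≃_ public

  ≃-refl : {p : Sum} → p ≃ p
  ≃-refl = coeffwise λ _ → refl

  ≃-sym : {p q : Sum} → p ≃ q → q ≃ p
  ≃-sym e = coeffwise λ k → sym (at e k)

  ≃-trans : {p q r : Sum} → p ≃ q → q ≃ r → p ≃ r
  ≃-trans e f = coeffwise λ k → trans (at e k) (at f k)

  ≡⇒≃ : {p q : Sum} → p ≡ q → p ≃ q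
  ≡⇒≃ refl = ≃-refl

  ≃-setoid : Setoid 0ℓ 0ℓ
  ≃-setoid = record
    { Carrier = Sum ; _≈_ = _≃_
    ; isEquivalence = record { refl = ≃-refl ; sym = ≃-sym ; trans = ≃-trans } }

  scale : ℚ → Sum → Sum
  scale c = map (λ { (d , k) → (c *ℚ d , k) })

  coeffOf-++ : ∀ p q k → coeffOf (p ++ q) k ≡ coeffOf p k +ℚ coeffOf q k
  coeffOf-++ []            q k = sym (ℚ.+-identityˡ _)
  coeffOf-++ ((c , u) ∷ p) q k =
    trans (cong (δ +ℚ_) (coeffOf-++ p q k)) (sym (ℚ.+-assoc δ (coeffOf p k) (coeffOf q k)))
    where δ = if does (u ≟ k) then c else 0ℚ

  coeffOf-scale : ∀ c p k → coeffOf (scale c p) k ≡ c *ℚ coeffOf p k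
  coeffOf-scale c []            k = sym (ℚ.*-zeroʳ c)
  coeffOf-scale c ((d , u) ∷ p) k =
    trans (cong₂ _+ℚ_ (if-*ʳ (does (u ≟ k)) c d) (coeffOf-scale c p k))
          (sym (ℚ.*-distribˡ-+ c _ (coeffOf p k)))

  ++-cong : {p p′ q q′ : Sum} → p ≃ p′ → q ≃ q′ → p ++ q ≃ p′ ++ q′
  ++-cong {p} {p′} {q} {q′} e f = coeffwise λ k →
    trans (coeffOf-++ p q k) (trans (cong₂ _+ℚ_ (at e k) (at f k)) (sym (coeffOf-++ p′ q′ k)))

  ∑ : Sum → (K → ℚ) → ℚ
  ∑ []            g = 0ℚ
  ∑ ((c , k) ∷ p) g = c *ℚ g k +ℚ ∑ p g

  ∑-ext : ∀ p {g h : K → ℚ} → (∀ k → g k ≡ h k) → ∑ p g ≡ ∑ p h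
  ∑-ext []            e = refl
  ∑-ext ((c , k) ∷ p) e = cong₂ _+ℚ_ (cong (c *ℚ_) (e k)) (∑-ext p e)

  ∑-++ : ∀ p q g → ∑ (p ++ q) g ≡ ∑ p g +ℚ ∑ q g
  ∑-++ []            q g = sym (ℚ.+-identityˡ _)
  ∑-++ ((c , k) ∷ p) q g =
    trans (cong (c *ℚ g k +ℚ_) (∑-++ p q g)) (sym (ℚ.+-assoc (c *ℚ g k) (∑ p g) (∑ q g)))

  ∑-scale : ∀ c p g → ∑ (scale c p) g ≡ c *ℚ ∑ p g
  ∑-scale c []            g = sym (ℚ.*-zeroʳ c)
  ∑-scale c ((d , k) ∷ p) g =
    trans (cong₂ _+ℚ_ (ℚ.*-assoc c d (g k)) (∑-scale c p g))
          (sym (ℚ.*-distribˡ-+ c (d *ℚ g k) (∑ p g)))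

  ∑-+ : ∀ p (g h : K → ℚ) → ∑ p (λ k → g k +ℚ h k) ≡ ∑ p g +ℚ ∑ p h
  ∑-+ []            g h = sym (ℚ.+-identityˡ 0ℚ)
  ∑-+ ((c , k) ∷ p) g h =
    trans (cong₂ _+ℚ_ (ℚ.*-distribˡ-+ c (g k) (h k)) (∑-+ p g h))
          (solve 4 (λ a b c d → (a :+ b) :+ (c :+ d) := (a :+ c) :+ (b :+ d)) refl
                 (c *ℚ g k) (c *ℚ h k) (∑ p g) (∑ p h))

  ∑-* : ∀ p c (g : K → ℚ) → ∑ p (λ k → c *ℚ g k) ≡ c *ℚ ∑ p g
  ∑-* []            c g = sym (ℚ.*-zeroʳ c)
  ∑-* ((d , k) ∷ p) c g =
    trans (cong₂ _+ℚ_ (solve 3 (λ d c a → d :* (c :* a) := c :* (d :* a)) refl d c (g k)) (∑-* p c g))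
          (sym (ℚ.*-distribˡ-+ c (d *ℚ g k) (∑ p g)))

  ∑-zero : ∀ p → ∑ p (λ _ → 0ℚ) ≡ 0ℚ
  ∑-zero []            = refl
  ∑-zero ((c , k) ∷ p) = trans (cong₂ _+ℚ_ (ℚ.*-zeroʳ c) (∑-zero p)) (ℚ.+-identityˡ 0ℚ)

  remove : K → Sum → Sum
  remove k []            = []
  remove k ((c , u) ∷ p) = if does (u ≟ k) then remove k p else (c , u) ∷ remove k p

  ∑-remove : ∀ k p g → ∑ p g ≡ coeffOf p k *ℚ g k +ℚ ∑ (remove k p) g
  ∑-remove k []            g = sym (trans (cong (_+ℚ 0ℚ) (ℚ.*-zeroˡ (g k))) (ℚ.+-identityʳ 0ℚ))
  ∑-remove k ((c , u) ∷ p) g with u ≟ k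
  ... | yes refl = trans (cong (c *ℚ g u +ℚ_) (∑-remove k p g))
      (solve 4 (λ c a g s → c :* g :+ (a :* g :+ s) := (c :+ a) :* g :+ s) refl c (coeffOf p k) (g k) _)
  ... | no _ = trans (cong (c *ℚ g u +ℚ_) (∑-remove k p g))
      (solve 5 (λ c h a g s → c :* h :+ (a :* g :+ s) := (con 0ℚ :+ a) :* g :+ (c :* h :+ s)) refl
             c (g u) (coeffOf p k) (g k) _)

  coeffOf-remove-≡ : ∀ k p → coeffOf (remove k p) k ≡ 0ℚ
  coeffOf-remove-≡ k []            = refl
  coeffOf-remove-≡ k ((c , u) ∷ p) with u ≟ k
  ... | yes refl = coeffOf-remove-≡ k p
  ... | no u≢k rewrite dec-false (u ≟ k) u≢k = trans (ℚ.+-identityˡ _) (coeffOf-remove-≡ k p)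

  coeffOf-remove-≢ : ∀ {k k′} p → k ≢ k′ → coeffOf (remove k p) k′ ≡ coeffOf p k′
  coeffOf-remove-≢ []            k≢k′ = refl
  coeffOf-remove-≢ {k} {k′} ((c , u) ∷ p) k≢k′ with u ≟ k
  ... | yes refl rewrite dec-false (u ≟ k′) k≢k′ =
    trans (coeffOf-remove-≢ p k≢k′) (sym (ℚ.+-identityˡ _))
  ... | no _ = cong ((if does (u ≟ k′) then c else 0ℚ) +ℚ_) (coeffOf-remove-≢ p k≢k′)

  length-remove : ∀ k p → length (remove k p) ≤ length p
  length-remove k []            = z≤n
  length-remove k ((c , u) ∷ p) with does (u ≟ k)
  ... | true  = ℕ.m≤n⇒m≤1+n (length-remove k p)
  ... | false = s≤s (length-remove k p)

  -- Strong induction on the length: removing the head key keeps all coefficients zero.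
  ∑-null : ∀ p g → (∀ k → coeffOf p k ≡ 0ℚ) → ∑ p g ≡ 0ℚ
  ∑-null p g = go (length p) p ℕ.≤-refl
    where
    go : ∀ m p → length p ≤ m → (∀ k → coeffOf p k ≡ 0ℚ) → ∑ p g ≡ 0ℚ
    go _       []            _       _    = refl
    go (suc m) ((c , u) ∷ p) (s≤s l) null = begin
      c *ℚ g u +ℚ ∑ p g                                         ≡⟨ cong (c *ℚ g u +ℚ_) (∑-remove u p g) ⟩
      c *ℚ g u +ℚ (coeffOf p u *ℚ g u +ℚ ∑ (remove u p) g)      ≡⟨ solve 4 (λ c a g s → c :* g :+ (a :* g :+ s) := (c :+ a) :* g :+ s) refl c (coeffOf p u) (g u) _ ⟩
      (c +ℚ coeffOf p u) *ℚ g u +ℚ ∑ (remove u p) g             ≡⟨ cong₂ (λ a b → a *ℚ g u +ℚ b) head-null (go m (remove u p) (ℕ.≤-trans (length-remove u p) l) rest-null) ⟩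
      0ℚ *ℚ g u +ℚ 0ℚ                                          ≡⟨ solve 1 (λ a → con 0ℚ :* a :+ con 0ℚ := con 0ℚ) refl (g u) ⟩
      0ℚ                                                        ∎
      where
      open ≡-Reasoning
      head-null : c +ℚ coeffOf p u ≡ 0ℚ
      head-null = trans (cong (λ b → (if b then c else 0ℚ) +ℚ coeffOf p u) (sym (dec-true (u ≟ u) refl))) (null u)
      rest-null : ∀ k → coeffOf (remove u p) k ≡ 0ℚ
      rest-null k with u ≟ k
      ... | yes refl = coeffOf-remove-≡ u p
      ... | no u≢k   = trans (coeffOf-remove-≢ p u≢k)
          (trans (sym (ℚ.+-identityˡ _)) (trans (cong (λ b → (if b then c else 0ℚ) +ℚ coeffOf p k) (sym (dec-false (u ≟ k) u≢k))) (null k)))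

  ∑-cong : ∀ {p q} g → p ≃ q → ∑ p g ≡ ∑ q g
  ∑-cong {p} {q} g e = x∙y⁻¹≈ε⇒x≈y (∑ p g) (∑ q g) (begin
    ∑ p g +ℚ - ∑ q g                    ≡⟨ cong (∑ p g +ℚ_) (sym (trans (∑-scale (- 1ℚ) q g) (-1*-neg _))) ⟩
    ∑ p g +ℚ ∑ (scale (- 1ℚ) q) g       ≡⟨ sym (∑-++ p _ g) ⟩
    ∑ (p ++ scale (- 1ℚ) q) g           ≡⟨ ∑-null (p ++ scale (- 1ℚ) q) g null ⟩
    0ℚ                                  ∎)
    where
    open ≡-Reasoning
    null : ∀ k → coeffOf (p ++ scale (- 1ℚ) q) k ≡ 0ℚ
    null k = begin
      coeffOf (p ++ scale (- 1ℚ) q) k           ≡⟨ coeffOf-++ p _ k ⟩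
      coeffOf p k +ℚ coeffOf (scale (- 1ℚ) q) k  ≡⟨ cong₂ _+ℚ_ (at e k) (trans (coeffOf-scale (- 1ℚ) q k) (-1*-neg _)) ⟩
      coeffOf q k +ℚ - coeffOf q k                ≡⟨ ℚ.+-inverseʳ (coeffOf q k) ⟩
      0ℚ                                         ∎

_≟W₁_ : DecidableEquality Word₁
ε₁       ≟W₁ ε₁       = yes refl
ε₁       ≟W₁ (_ ▷₁ _) = no λ ()
(_ ▷₁ _) ≟W₁ ε₁       = no λ ()
(u ▷₁ a) ≟W₁ (w ▷₁ b) with u ≟W₁ w
(u ▷₁ x₁) ≟W₁ (w ▷₁ x₁) | yes refl = yes refl
(u ▷₁ y₁) ≟W₁ (w ▷₁ y₁) | yes refl = yes refl
(u ▷₁ x₁) ≟W₁ (w ▷₁ y₁) | yes refl = no λ ()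
(u ▷₁ y₁) ≟W₁ (w ▷₁ x₁) | yes refl = no λ ()
... | no u≢w = no λ { refl → u≢w refl }

open module PolySums {n : ℕ} = FormalSums (_≟W_ {n})
  using (coeffOf; _≃_; coeffwise; at; ≃-refl; ≃-sym; ≃-trans; ≡⇒≃; ≃-setoid; coeffOf-++; ++-cong; scale; coeffOf-scale)

module Sums₁ = FormalSums _≟W₁_
open Sums₁ using ()
  renaming (_≃_ to _≃₁_; coeffwise to coeffwise₁; ≃-sym to ≃₁-sym; ≃-trans to ≃₁-trans; ≡⇒≃ to ≡⇒≃₁)

private variable
  n m : ℕ

coeff≡coeffOf : (p : Poly n) (w : Word n) → coeff p w ≡ coeffOf p w
coeff≡coeffOf []            w = refl
coeff≡coeffOf ((c , u) ∷ p) w = cong ((if does (u ≟W w) then c else 0ℚ) +ℚ_) (coeff≡coeffOf p w)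

⊛≡scale : (c : ℚ) (p : Poly n) → c ⊛ p ≡ scale c p
⊛≡scale c []            = refl
⊛≡scale c ((d , w) ∷ p) = cong ((c *ℚ d , w) ∷_) (⊛≡scale c p)

coeffOf-⊛ : (c : ℚ) (p : Poly n) (w : Word n) → coeffOf (c ⊛ p) w ≡ c *ℚ coeffOf p w
coeffOf-⊛ c p w = trans (cong (λ q → coeffOf q w) (⊛≡scale c p)) (coeffOf-scale c p w)

⊕-cong : {P P′ Q Q′ : Poly n} → P ≃ P′ → Q ≃ Q′ → P ⊕ Q ≃ P′ ⊕ Q′
⊕-cong = ++-cong

⊛-cong : (c : ℚ) {P Q : Poly n} → P ≃ Q → c ⊛ P ≃ c ⊛ Q
⊛-cong c {P} {Q} e = coeffwise λ w →
  trans (coeffOf-⊛ c P w) (trans (cong (c *ℚ_) (at e w)) (sym (coeffOf-⊛ c Q w)))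

⊝-cong : {P Q : Poly n} → P ≃ Q → ⊝ P ≃ ⊝ Q
⊝-cong = ⊛-cong (- 1ℚ)

⊖-cong : {P P′ Q Q′ : Poly n} → P ≃ P′ → Q ≃ Q′ → P ⊖ Q ≃ P′ ⊖ Q′
⊖-cong e f = ⊕-cong e (⊝-cong f)

-- The coefficient of v in P·a, as a function of the coefficients of P.
rightQuotient : Letter n → (Word n → ℚ) → Word n → ℚ
rightQuotient a f ε       = 0ℚ
rightQuotient a f (w ▷ b) = if does (a ≟L b) then f w else 0ℚ

rightQuotient-cong : (a : Letter n) {f g : Word n → ℚ} → (∀ w → f w ≡ g w) →
                     ∀ v → rightQuotient a f v ≡ rightQuotient a g v
rightQuotient-cong a f≡g ε       = refl
rightQuotient-cong a f≡g (w ▷ b) = cong (λ q → if does (a ≟L b) then q else 0ℚ) (f≡g w)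

last-letter-matches : (P : Poly n) (a : Letter n) (w : Word n) → coeffOf (P ▶ a) (w ▷ a) ≡ coeffOf P w
last-letter-differs : (P : Poly n) {a b : Letter n} {w : Word n} → a ≢ b → coeffOf (P ▶ a) (w ▷ b) ≡ 0ℚ

coeffOf-▶ : (P : Poly n) (a : Letter n) (v : Word n) → coeffOf (P ▶ a) v ≡ rightQuotient a (coeffOf P) v
coeffOf-▶ []            a ε       = refl
coeffOf-▶ []            a (w ▷ b) with does (a ≟L b)
... | true  = refl
... | false = refl
coeffOf-▶ ((c , u) ∷ P) a ε       = trans (ℚ.+-identityˡ _) (coeffOf-▶ P a ε)
coeffOf-▶ ((c , u) ∷ P) a (w ▷ b) with u ≟W w | a ≟L b
... | yes refl | yes refl = cong (c +ℚ_) (last-letter-matches P a u)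
... | no _     | yes refl = cong (0ℚ +ℚ_) (last-letter-matches P a w)
... | yes refl | no a≢b   = trans (ℚ.+-identityˡ _) (last-letter-differs P a≢b)
... | no _     | no a≢b   = trans (ℚ.+-identityˡ _) (last-letter-differs P a≢b)

last-letter-matches P a w =
  trans (coeffOf-▶ P a (w ▷ a)) (cong (λ d → if d then coeffOf P w else 0ℚ) (dec-true (a ≟L a) refl))
last-letter-differs P {a} {b} {w} a≢b =
  trans (coeffOf-▶ P a (w ▷ b)) (cong (λ d → if d then coeffOf P w else 0ℚ) (dec-false (a ≟L b) a≢b))

▶-cong : (a : Letter n) {P Q : Poly n} → P ≃ Q → P ▶ a ≃ Q ▶ a
▶-cong a {P} {Q} e = coeffwise λ v →
  trans (coeffOf-▶ P a v) (trans (rightQuotient-cong a (at e) v) (sym (coeffOf-▶ Q a v)))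

rightQuotient-∑ : {I : Set} (_≟_ : DecidableEquality I) (a : Letter n) (p : FormalSums.Sum _≟_)
  (h : I → Word n → ℚ) (v : Word n) →
  rightQuotient a (λ w → FormalSums.∑ _≟_ p (λ i → h i w)) v ≡ FormalSums.∑ _≟_ p (λ i → rightQuotient a (h i) v)
rightQuotient-∑ _≟_ a p h ε       = sym (FormalSums.∑-zero _≟_ p)
rightQuotient-∑ _≟_ a p h (w ▷ b) with does (a ≟L b)
... | true  = refl
... | false = sym (FormalSums.∑-zero _≟_ p)

-- Expressions in polynomial variables, built from sums, negation and right multiplication by
-- letters; they are decided by expansion into monomials `variable · letter word`.
data Expr : Set where
  var   : ℕ → Expr
  nil   : Expr
  _⊕E_  : Expr → Expr → Expr
  ⊝E_   : Expr → Expr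
  _▷E_  : Expr → ℕ → Expr

infixl 6 _⊕E_ _⊖E_
infixl 7 _▷E_
infix  8 ⊝E_

_⊖E_ : Expr → Expr → Expr
a ⊖E b = a ⊕E (⊝E b)

v0 v1 v2 v3 v4 v5 v6 v7 v8 v9 : Expr
v0 = var 0
v1 = var 1
v2 = var 2
v3 = var 3
v4 = var 4
v5 = var 5
v6 = var 6
v7 = var 7
v8 = var 8
v9 = var 9

lookupPoly : List (Poly n) → ℕ → Poly n
lookupPoly []      _       = []
lookupPoly (P ∷ _) zero    = P
lookupPoly (_ ∷ σ) (suc i) = lookupPoly σ i

lookupLetter : List (Letter n) → ℕ → Letter n
lookupLetter []      _       = x
lookupLetter (a ∷ _) zero    = a
lookupLetter (_ ∷ ℓ) (suc j) = lookupLetter ℓ j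

⟦_⟧ : Expr → List (Poly n) → List (Letter n) → Poly n
⟦ var i  ⟧ σ ℓ = lookupPoly σ i
⟦ nil    ⟧ σ ℓ = []
⟦ a ⊕E b ⟧ σ ℓ = ⟦ a ⟧ σ ℓ ⊕ ⟦ b ⟧ σ ℓ
⟦ ⊝E a   ⟧ σ ℓ = ⊝ ⟦ a ⟧ σ ℓ
⟦ a ▷E j ⟧ σ ℓ = ⟦ a ⟧ σ ℓ ▶ lookupLetter ℓ j

-- A monomial (i , jₖ ∷ … ∷ j₁ ∷ []) stands for variable i followed by the letters j₁ … jₖ.
Monomial : Set
Monomial = ℕ × List ℕ

_≟M_ : DecidableEquality Monomial
_≟M_ = ×-≡-dec ℕ._≟_ (List-≡-dec ℕ._≟_)

module MonomialSums = FormalSums _≟M_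

⟦_⟧ₘ : Monomial → List (Poly n) → List (Letter n) → Poly n
⟦ i , []     ⟧ₘ σ ℓ = lookupPoly σ i
⟦ i , j ∷ js ⟧ₘ σ ℓ = ⟦ i , js ⟧ₘ σ ℓ ▶ lookupLetter ℓ j

append : ℕ → ℚ × Monomial → ℚ × Monomial
append j (c , (i , js)) = (c , (i , j ∷ js))

expand : Expr → MonomialSums.Sum
expand (var i)  = (1ℚ , (i , [])) ∷ []
expand nil      = []
expand (a ⊕E b) = expand a ++ expand b
expand (⊝E a)   = MonomialSums.scale (- 1ℚ) (expand a)
expand (a ▷E j) = map (append j) (expand a)

module _ (σ : List (Poly n)) (ℓ : List (Letter n)) where
  open MonomialSums using (∑; ∑-++; ∑-scale; ∑-ext)

  ∑-append : ∀ j L (g : Monomial → ℚ) → ∑ (map (append j) L) g ≡ ∑ L (λ { (i , js) → g (i , j ∷ js) })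
  ∑-append j []                   g = refl
  ∑-append j ((c , (i , js)) ∷ L) g = cong (c *ℚ g (i , j ∷ js) +ℚ_) (∑-append j L g)

  coeffOf-⟦⟧ : ∀ e v → coeffOf (⟦ e ⟧ σ ℓ) v ≡ ∑ (expand e) (λ k → coeffOf (⟦ k ⟧ₘ σ ℓ) v)
  coeffOf-⟦⟧ (var i)  v = sym (trans (ℚ.+-identityʳ _) (ℚ.*-identityˡ _))
  coeffOf-⟦⟧ nil      v = refl
  coeffOf-⟦⟧ (a ⊕E b) v = trans (coeffOf-++ (⟦ a ⟧ σ ℓ) _ v)
    (trans (cong₂ _+ℚ_ (coeffOf-⟦⟧ a v) (coeffOf-⟦⟧ b v)) (sym (∑-++ (expand a) (expand b) _)))
  coeffOf-⟦⟧ (⊝E a)   v = trans (coeffOf-⊛ (- 1ℚ) (⟦ a ⟧ σ ℓ) v)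
    (trans (cong ((- 1ℚ) *ℚ_) (coeffOf-⟦⟧ a v)) (sym (∑-scale (- 1ℚ) (expand a) _)))
  coeffOf-⟦⟧ (a ▷E j) v = begin
    coeffOf (⟦ a ⟧ σ ℓ ▶ l) v                                           ≡⟨ coeffOf-▶ (⟦ a ⟧ σ ℓ) l v ⟩
    rightQuotient l (coeffOf (⟦ a ⟧ σ ℓ)) v                             ≡⟨ rightQuotient-cong l (coeffOf-⟦⟧ a) v ⟩
    rightQuotient l (λ w → ∑ (expand a) (λ k → coeffOf (⟦ k ⟧ₘ σ ℓ) w)) v ≡⟨ rightQuotient-∑ _≟M_ l (expand a) (λ k → coeffOf (⟦ k ⟧ₘ σ ℓ)) v ⟩
    ∑ (expand a) (λ k → rightQuotient l (coeffOf (⟦ k ⟧ₘ σ ℓ)) v)       ≡⟨ ∑-ext (expand a) (λ { (i , js) → sym (coeffOf-▶ (⟦ i , js ⟧ₘ σ ℓ) l v) }) ⟩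
    ∑ (expand a) (λ { (i , js) → coeffOf (⟦ i , j ∷ js ⟧ₘ σ ℓ) v })     ≡⟨ sym (∑-append j (expand a) _) ⟩
    ∑ (map (append j) (expand a)) (λ k → coeffOf (⟦ k ⟧ₘ σ ℓ) v)        ∎
    where
    open ≡-Reasoning
    l = lookupLetter ℓ j

Vanishes : MonomialSums.Sum → Set
Vanishes L = All (λ e → MonomialSums.coeffOf L (proj₂ e) ≡ 0ℚ) L

vanishes? : ∀ L → Dec (Vanishes L)
vanishes? L = all? (λ e → MonomialSums.coeffOf L (proj₂ e) ℚ.≟ 0ℚ) L

occurs-or-zero : ∀ L k → Any (λ e → proj₂ e ≡ k) L ⊎ MonomialSums.coeffOf L k ≡ 0ℚ
occurs-or-zero []             k = inj₂ refl
occurs-or-zero ((c , k′) ∷ L) k with k′ ≟M k | occurs-or-zero L k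
... | yes k′≡k | _        = inj₁ (here k′≡k)
... | no _     | inj₁ occ = inj₁ (there occ)
... | no _     | inj₂ z   = inj₂ (trans (ℚ.+-identityˡ _) z)

vanishes-everywhere : ∀ L → Vanishes L → ∀ k → MonomialSums.coeffOf L k ≡ 0ℚ
vanishes-everywhere L v k with occurs-or-zero L k
... | inj₁ occ = lookupWith (λ z k′≡k → subst (λ k → MonomialSums.coeffOf L k ≡ 0ℚ) k′≡k z) v occ
... | inj₂ z   = z

solveₑ : (a b : Expr) (σ : List (Poly n)) (ℓ : List (Letter n)) →
         {True (vanishes? (expand (a ⊖E b)))} → ⟦ a ⟧ σ ℓ ≃ ⟦ b ⟧ σ ℓ
solveₑ a b σ ℓ {ok} = coeffwise λ v → x∙y⁻¹≈ε⇒x≈y _ _ (begin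
  coeffOf (⟦ a ⟧ σ ℓ) v +ℚ - coeffOf (⟦ b ⟧ σ ℓ) v   ≡⟨ cong (coeffOf (⟦ a ⟧ σ ℓ) v +ℚ_) (trans (sym (-1*-neg _)) (sym (coeffOf-⊛ (- 1ℚ) (⟦ b ⟧ σ ℓ) v))) ⟩
  coeffOf (⟦ a ⟧ σ ℓ) v +ℚ coeffOf (⟦ ⊝E b ⟧ σ ℓ) v   ≡⟨ sym (coeffOf-++ (⟦ a ⟧ σ ℓ) _ v) ⟩
  coeffOf (⟦ a ⊖E b ⟧ σ ℓ) v                         ≡⟨ coeffOf-⟦⟧ σ ℓ (a ⊖E b) v ⟩
  MonomialSums.∑ (expand (a ⊖E b)) _                   ≡⟨ MonomialSums.∑-null (expand (a ⊖E b)) _ (vanishes-everywhere _ (toWitness ok)) ⟩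
  0ℚ                                                  ∎)
  where open ≡-Reasoning

⟦⟧-cong : (e : Expr) {σ τ : List (Poly n)} (ℓ : List (Letter n)) → Pointwise _≃_ σ τ → ⟦ e ⟧ σ ℓ ≃ ⟦ e ⟧ τ ℓ
⟦⟧-cong (var i)  ℓ σ≃τ = lookup-cong σ≃τ i
  where
  lookup-cong : ∀ {σ τ} → Pointwise _≃_ σ τ → ∀ i → lookupPoly σ i ≃ lookupPoly τ i
  lookup-cong []         i       = ≃-refl
  lookup-cong (P≃Q ∷ _)  zero    = P≃Q
  lookup-cong (_ ∷ σ≃τ)  (suc i) = lookup-cong σ≃τ i
⟦⟧-cong nil      ℓ σ≃τ = ≃-refl
⟦⟧-cong (a ⊕E b) ℓ σ≃τ = ⊕-cong (⟦⟧-cong a ℓ σ≃τ) (⟦⟧-cong b ℓ σ≃τ)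
⟦⟧-cong (⊝E a)   ℓ σ≃τ = ⊝-cong (⟦⟧-cong a ℓ σ≃τ)
⟦⟧-cong (a ▷E j) ℓ σ≃τ = ▶-cong (lookupLetter ℓ j) (⟦⟧-cong a ℓ σ≃τ)

lookupExpr : List Expr → ℕ → Expr
lookupExpr []       _       = nil
lookupExpr (e ∷ _)  zero    = e
lookupExpr (_ ∷ es) (suc i) = lookupExpr es i

substitute : Expr → List Expr → Expr
substitute (var i)  es = lookupExpr es i
substitute nil      es = nil
substitute (a ⊕E b) es = substitute a es ⊕E substitute b es
substitute (⊝E a)   es = ⊝E substitute a es
substitute (a ▷E j) es = substitute a es ▷E j

⟦⟧-substitute : (e : Expr) (es : List Expr) (τ : List (Poly n)) (ℓ : List (Letter n)) →
                ⟦ e ⟧ (map (λ e′ → ⟦ e′ ⟧ τ ℓ) es) ℓ ≡ ⟦ substitute e es ⟧ τ ℓ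
⟦⟧-substitute (var i)  es τ ℓ = lookup-map es i
  where
  lookup-map : ∀ es i → lookupPoly (map (λ e′ → ⟦ e′ ⟧ τ ℓ) es) i ≡ ⟦ lookupExpr es i ⟧ τ ℓ
  lookup-map []       i       = refl
  lookup-map (e ∷ es) zero    = refl
  lookup-map (e ∷ es) (suc i) = lookup-map es i
⟦⟧-substitute nil      es τ ℓ = refl
⟦⟧-substitute (a ⊕E b) es τ ℓ = cong₂ _⊕_ (⟦⟧-substitute a es τ ℓ) (⟦⟧-substitute b es τ ℓ)
⟦⟧-substitute (⊝E a)   es τ ℓ = cong ⊝_ (⟦⟧-substitute a es τ ℓ)
⟦⟧-substitute (a ▷E j) es τ ℓ = cong (_▶ lookupLetter ℓ j) (⟦⟧-substitute a es τ ℓ)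

rewriteₑ : (e : Expr) (es : List Expr) {σ : List (Poly n)} (τ : List (Poly n)) (ℓ : List (Letter n)) →
           Pointwise _≃_ σ (map (λ e′ → ⟦ e′ ⟧ τ ℓ) es) → ⟦ e ⟧ σ ℓ ≃ ⟦ substitute e es ⟧ τ ℓ
rewriteₑ e es τ ℓ σ≃ = ≃-trans (⟦⟧-cong e ℓ σ≃) (≡⇒≃ (⟦⟧-substitute e es τ ℓ))

module LinearExtension {I : Set} (_≟_ : DecidableEquality I) {n : ℕ} where

  private module S = FormalSums _≟_

  extend : (I → Poly n) → S.Sum → Poly n
  extend f []            = []
  extend f ((c , i) ∷ p) = c ⊛ f i ++ extend f p

  coeffOf-extend : ∀ f p w → coeffOf (extend f p) w ≡ S.∑ p (λ i → coeffOf (f i) w)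
  coeffOf-extend f []            w = refl
  coeffOf-extend f ((c , i) ∷ p) w =
    trans (coeffOf-++ (c ⊛ f i) (extend f p) w) (cong₂ _+ℚ_ (coeffOf-⊛ c (f i) w) (coeffOf-extend f p w))

  extend-cong : ∀ f {p q} → p S.≃ q → extend f p ≃ extend f q
  extend-cong f {p} {q} e = coeffwise λ w →
    trans (coeffOf-extend f p w) (trans (S.∑-cong _ e) (sym (coeffOf-extend f q w)))

  extend-ext : ∀ {f g} p → (∀ i → f i ≃ g i) → extend f p ≃ extend g p
  extend-ext {f} {g} p e = coeffwise λ w →
    trans (coeffOf-extend f p w) (trans (S.∑-ext p (λ i → at (e i) w)) (sym (coeffOf-extend g p w)))

  extend-++ : ∀ f p q → extend f (p ++ q) ≃ extend f p ⊕ extend f q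
  extend-++ f p q = coeffwise λ w → begin
    coeffOf (extend f (p ++ q)) w                                  ≡⟨ coeffOf-extend f (p ++ q) w ⟩
    S.∑ (p ++ q) _                                                  ≡⟨ S.∑-++ p q _ ⟩
    S.∑ p _ +ℚ S.∑ q _                                              ≡⟨ sym (cong₂ _+ℚ_ (coeffOf-extend f p w) (coeffOf-extend f q w)) ⟩
    coeffOf (extend f p) w +ℚ coeffOf (extend f q) w               ≡⟨ sym (coeffOf-++ (extend f p) (extend f q) w) ⟩
    coeffOf (extend f p ⊕ extend f q) w                            ∎
    where open ≡-Reasoning

  extend-scale : ∀ f c p → extend f (S.scale c p) ≃ c ⊛ extend f p
  extend-scale f c p = coeffwise λ w →
    trans (coeffOf-extend f (S.scale c p) w) (trans (S.∑-scale c p _)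
      (trans (cong (c *ℚ_) (sym (coeffOf-extend f p w))) (sym (coeffOf-⊛ c (extend f p) w))))

  extend-single : ∀ f i → extend f ((1ℚ , i) ∷ []) ≃ f i
  extend-single f i = coeffwise λ w →
    trans (coeffOf-++ (1ℚ ⊛ f i) [] w) (trans (ℚ.+-identityʳ _) (trans (coeffOf-⊛ 1ℚ (f i) w) (ℚ.*-identityˡ _)))

  extend-zero : ∀ p → [] ≃ extend (λ _ → []) p
  extend-zero p = coeffwise λ w → sym (trans (coeffOf-extend (λ _ → []) p w) (S.∑-zero p))

  extend-⊕ : ∀ f g p → extend f p ⊕ extend g p ≃ extend (λ i → f i ⊕ g i) p
  extend-⊕ f g p = coeffwise λ w → begin
    coeffOf (extend f p ⊕ extend g p) w                      ≡⟨ coeffOf-++ (extend f p) (extend g p) w ⟩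
    coeffOf (extend f p) w +ℚ coeffOf (extend g p) w         ≡⟨ cong₂ _+ℚ_ (coeffOf-extend f p w) (coeffOf-extend g p w) ⟩
    S.∑ p _ +ℚ S.∑ p _                                        ≡⟨ sym (S.∑-+ p _ _) ⟩
    S.∑ p _                                                   ≡⟨ S.∑-ext p (λ i → sym (coeffOf-++ (f i) (g i) w)) ⟩
    S.∑ p (λ i → coeffOf (f i ⊕ g i) w)                      ≡⟨ sym (coeffOf-extend _ p w) ⟩
    coeffOf (extend (λ i → f i ⊕ g i) p) w                   ∎
    where open ≡-Reasoning

  extend-⊛ : ∀ c f p → c ⊛ extend f p ≃ extend (λ i → c ⊛ f i) p
  extend-⊛ c f p = coeffwise λ w → begin
    coeffOf (c ⊛ extend f p) w                ≡⟨ coeffOf-⊛ c (extend f p) w ⟩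
    c *ℚ coeffOf (extend f p) w               ≡⟨ cong (c *ℚ_) (coeffOf-extend f p w) ⟩
    c *ℚ S.∑ p (λ i → coeffOf (f i) w)        ≡⟨ sym (S.∑-* p c _) ⟩
    S.∑ p (λ i → c *ℚ coeffOf (f i) w)        ≡⟨ S.∑-ext p (λ i → sym (coeffOf-⊛ c (f i) w)) ⟩
    S.∑ p (λ i → coeffOf (c ⊛ f i) w)         ≡⟨ sym (coeffOf-extend _ p w) ⟩
    coeffOf (extend (λ i → c ⊛ f i) p) w      ∎
    where open ≡-Reasoning

  extend-⊝ : ∀ f p → ⊝ extend f p ≃ extend (λ i → ⊝ f i) p
  extend-⊝ = extend-⊛ (- 1ℚ)

  extend-▶ : ∀ a f p → extend f p ▶ a ≃ extend (λ i → f i ▶ a) p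
  extend-▶ a f p = coeffwise λ v → begin
    coeffOf (extend f p ▶ a) v                              ≡⟨ coeffOf-▶ (extend f p) a v ⟩
    rightQuotient a (coeffOf (extend f p)) v                ≡⟨ rightQuotient-cong a (coeffOf-extend f p) v ⟩
    rightQuotient a (λ w → S.∑ p (λ i → coeffOf (f i) w)) v ≡⟨ rightQuotient-∑ _≟_ a p (λ i → coeffOf (f i)) v ⟩
    S.∑ p (λ i → rightQuotient a (coeffOf (f i)) v)         ≡⟨ S.∑-ext p (λ i → sym (coeffOf-▶ (f i) a v)) ⟩
    S.∑ p (λ i → coeffOf (f i ▶ a) v)                       ≡⟨ sym (coeffOf-extend _ p v) ⟩
    coeffOf (extend (λ i → f i ▶ a) p) v                    ∎
    where open ≡-Reasoning

  extend-lookup : ∀ (fs : List (I → Poly n)) p j →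
    lookupPoly (map (λ f → extend f p) fs) j ≃ extend (λ i → lookupPoly (map (λ f → f i) fs) j) p
  extend-lookup []       p j       = extend-zero p
  extend-lookup (f ∷ fs) p zero    = ≃-refl
  extend-lookup (f ∷ fs) p (suc j) = extend-lookup fs p j

  extend-⟦⟧ : ∀ e (fs : List (I → Poly n)) ℓ p →
    ⟦ e ⟧ (map (λ f → extend f p) fs) ℓ ≃ extend (λ i → ⟦ e ⟧ (map (λ f → f i) fs) ℓ) p
  extend-⟦⟧ (var j)  fs ℓ p = extend-lookup fs p j
  extend-⟦⟧ nil      fs ℓ p = extend-zero p
  extend-⟦⟧ (a ⊕E b) fs ℓ p = ≃-trans (⊕-cong (extend-⟦⟧ a fs ℓ p) (extend-⟦⟧ b fs ℓ p)) (extend-⊕ _ _ p)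
  extend-⟦⟧ (⊝E a)   fs ℓ p = ≃-trans (⊝-cong (extend-⟦⟧ a fs ℓ p)) (extend-⊝ _ p)
  extend-⟦⟧ (a ▷E j) fs ℓ p = ≃-trans (▶-cong (lookupLetter ℓ j) (extend-⟦⟧ a fs ℓ p)) (extend-▶ (lookupLetter ℓ j) _ p)

  extend-identity : ∀ e₁ e₂ (fs gs : List (I → Poly n)) ℓ →
    (∀ i → ⟦ e₁ ⟧ (map (λ f → f i) fs) ℓ ≃ ⟦ e₂ ⟧ (map (λ g → g i) gs) ℓ) →
    ∀ p → ⟦ e₁ ⟧ (map (λ f → extend f p) fs) ℓ ≃ ⟦ e₂ ⟧ (map (λ g → extend g p) gs) ℓ
  extend-identity e₁ e₂ fs gs ℓ pointwise p =
    ≃-trans (extend-⟦⟧ e₁ fs ℓ p) (≃-trans (extend-ext p pointwise) (≃-sym (extend-⟦⟧ e₂ gs ℓ p)))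

open module ExtendW {n m : ℕ} = LinearExtension (_≟W_ {n}) {m}
module Extend₁ {n : ℕ} = LinearExtension _≟W₁_ {n}
open Extend₁ using () renaming (extend to extend₁; extend-cong to extend₁-cong; extend-ext to extend₁-ext;
  extend-++ to extend₁-++; extend-scale to extend₁-scale; extend-single to extend₁-single;
  extend-zero to extend₁-zero; extend-⊕ to extend₁-⊕; extend-⊛ to extend₁-⊛; extend-⟦⟧ to extend₁-⟦⟧;
  extend-identity to extend₁-identity)

lin≡extend : (f : Word n → Poly m) (p : Poly n) → lin f p ≡ extend f p
lin≡extend f []            = refl
lin≡extend f ((c , w) ∷ p) = cong (c ⊛ f w ++_) (lin≡extend f p)

lin₁≡extend : (f : Word₁ → Poly n) (p : Poly₁) → lin₁ f p ≡ extend₁ f p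
lin₁≡extend f []            = refl
lin₁≡extend f ((c , w) ∷ p) = cong (c ⊛ f w ++_) (lin₁≡extend f p)

extend-mon : (P : Poly n) → extend mon P ≃ P
extend-mon P = coeffwise λ v → trans (coeffOf-extend mon P v) (∑-mon P v)
  where
  ∑-mon : ∀ P v → PolySums.∑ P (λ w → coeffOf (mon w) v) ≡ coeffOf P v
  ∑-mon []            v = refl
  ∑-mon ((c , u) ∷ P) v = cong₂ _+ℚ_ (c*δ (does (u ≟W v))) (∑-mon P v)
    where
    c*δ : ∀ b → c *ℚ ((if b then 1ℚ else 0ℚ) +ℚ 0ℚ) ≡ (if b then c else 0ℚ)
    c*δ true  = trans (cong (c *ℚ_) (ℚ.+-identityʳ 1ℚ)) (ℚ.*-identityʳ c)
    c*δ false = trans (cong (c *ℚ_) (ℚ.+-identityʳ 0ℚ)) (ℚ.*-zeroʳ c)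

extend-▶-keys : (f : Word n → Poly m) (P : Poly n) (a : Letter n) → extend f (P ▶ a) ≡ extend (λ w → f (w ▷ a)) P
extend-▶-keys f []            a = refl
extend-▶-keys f ((c , w) ∷ P) a = cong (c ⊛ f (w ▷ a) ++_) (extend-▶-keys f P a)

extend-⊛-keys : (f : Word n → Poly m) (c : ℚ) (P : Poly n) → extend f (c ⊛ P) ≃ c ⊛ extend f P
extend-⊛-keys f c P = ≃-trans (≡⇒≃ (cong (extend f) (⊛≡scale c P))) (extend-scale f c P)

extend-extend₁ : (g : Word n → Poly m) (f : Word₁ → Poly n) (p : Poly₁) →
                 extend g (extend₁ f p) ≃ extend₁ (λ i → extend g (f i)) p
extend-extend₁ g f []            = ≃-refl
extend-extend₁ g f ((c , i) ∷ p) =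
  ≃-trans (extend-++ g (c ⊛ f i) (extend₁ f p)) (⊕-cong (extend-⊛-keys g c (f i)) (extend-extend₁ g f p))

-- A₁ inside A_r

_▶₁_ : Poly₁ → Letter₁ → Poly₁
p ▶₁ a = map (λ { (c , w) → (c , w ▷₁ a) }) p

infixl 7 _▶₁_

_▶₁z : Poly₁ → Poly₁
p ▶₁z = p ▶₁ x₁ ++ p ▶₁ y₁

infixl 7 _▶₁z

mon₁ : Word₁ → Poly₁
mon₁ w = (1ℚ , w) ∷ []

⊝₁_ : Poly₁ → Poly₁
⊝₁ p = Sums₁.scale (- 1ℚ) p

extend₁-▶-keys : (f : Word₁ → Poly n) (p : Poly₁) (a : Letter₁) → extend₁ f (p ▶₁ a) ≡ extend₁ (λ w → f (w ▷₁ a)) p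
extend₁-▶-keys f []            a = refl
extend₁-▶-keys f ((c , w) ∷ p) a = cong (c ⊛ f (w ▷₁ a) ++_) (extend₁-▶-keys f p a)

ι-▶ : (p : Poly₁) (a : Letter₁) → ι {n} (p ▶₁ a) ≡ ι p ▶ ιL a
ι-▶ []            a = refl
ι-▶ ((c , w) ∷ p) a = cong ((c , ιW w ▷ ιL a) ∷_) (ι-▶ p a)

ι-++ : (p q : Poly₁) → ι {n} (p ++ q) ≡ ι p ++ ι q
ι-++ []            q = refl
ι-++ ((c , w) ∷ p) q = cong ((c , ιW w) ∷_) (ι-++ p q)

ι-scale : (c : ℚ) (p : Poly₁) → ι {n} (Sums₁.scale c p) ≡ c ⊛ ι p
ι-scale c []            = refl
ι-scale c ((d , w) ∷ p) = cong ((c *ℚ d , ιW w) ∷_) (ι-scale c p)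

extend-ι : (g : Word n → Poly m) (p : Poly₁) → extend g (ι p) ≡ extend₁ (λ w → g (ιW w)) p
extend-ι g []            = refl
extend-ι g ((c , w) ∷ p) = cong (c ⊛ g (ιW w) ++_) (extend-ι g p)

ι≃extend₁ : (q : Poly₁) → ι {n} q ≃ extend₁ (λ u → mon (ιW u)) q
ι≃extend₁ q = ≃-trans (≃-sym (extend-mon (ι q))) (≡⇒≃ (extend-ι mon q))

ι-cong : {q q′ : Poly₁} → q ≃₁ q′ → ι {n} q ≃ ι q′
ι-cong {q = q} {q′} e = ≃-trans (ι≃extend₁ q) (≃-trans (extend₁-cong _ e) (≃-sym (ι≃extend₁ q′)))

toℕ-mod : (t : Fin (suc n)) → toℕ t mod suc n ≡ t
toℕ-mod t = Fin.toℕ-injective (trans (Fin.toℕ-fromℕ< _) (m<n⇒m%n≡m (Fin.toℕ<n t)))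

⊙-identityʳ : (t : Root n) → t ⊙ one ≡ t
⊙-identityʳ {n} t = trans (cong (_mod suc n) (ℕ.+-identityʳ (toℕ t))) (toℕ-mod t)

⊙-identityˡ : (t : Root n) → one ⊙ t ≡ t
⊙-identityˡ = toℕ-mod

_▶z : Poly n → Poly n
P ▶z = P ▶ x ⊕ P ▶ y one

_▶z[_] : Poly n → Root n → Poly n
P ▶z[ t ] = P ▶ x ⊕ P ▶ y t

_▶y−y[_] : Poly n → Root n → Poly n
P ▶y−y[ t ] = P ▶ y one ⊖ P ▶ y t

_▶φy[_] : Poly n → Root n → Poly n
P ▶φy[ fzero ]  = ⊝ (P ▶ y one)
P ▶φy[ fsuc k ] = P ▶ y (fsuc k) ⊖ P ▶ y one

infixl 7 _▶z _▶z[_] _▶y−y[_] _▶φy[_]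

▶z-cong : {P Q : Poly n} → P ≃ Q → P ▶z ≃ Q ▶z
▶z-cong e = ⊕-cong (▶-cong x e) (▶-cong (y one) e)

▶y−y-cong : (t : Root n) {P Q : Poly n} → P ≃ Q → P ▶y−y[ t ] ≃ Q ▶y−y[ t ]
▶y−y-cong t e = ⊖-cong (▶-cong (y one) e) (▶-cong (y t) e)

ι-▶z : (q : Poly₁) → ι {n} (q ▶₁z) ≡ ι q ▶z
ι-▶z q = trans (ι-++ (q ▶₁ x₁) (q ▶₁ y₁)) (cong₂ _++_ (ι-▶ q x₁) (ι-▶ q y₁))

▶φy-cong : (s : Root n) {P Q : Poly n} → P ≃ Q → P ▶φy[ s ] ≃ Q ▶φy[ s ]
▶φy-cong fzero    e = ⊝-cong (▶-cong (y one) e)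
▶φy-cong (fsuc k) e = ⊖-cong (▶-cong (y (fsuc k)) e) (▶-cong (y one) e)

-- (var 0)·φ(y_s) as an expression over the letters x, y, y_s
φyₑ : Root n → Expr
φyₑ fzero    = ⊝E (v0 ▷E 1)
φyₑ (fsuc k) = v0 ▷E 2 ⊖E v0 ▷E 1

▶φy≡⟦⟧ : (s : Root n) (P : Poly n) → P ▶φy[ s ] ≡ ⟦ φyₑ s ⟧ (P ∷ []) (x ∷ y one ∷ y s ∷ [])
▶φy≡⟦⟧ fzero    P = refl
▶φy≡⟦⟧ (fsuc k) P = refl

extend₁-⟦⟧₁ : (e : Expr) (ℓ : List (Letter n)) (f : Word₁ → Poly n) (p : Poly₁) →
              extend₁ (λ i → ⟦ e ⟧ (f i ∷ []) ℓ) p ≃ ⟦ e ⟧ (extend₁ f p ∷ []) ℓ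
extend₁-⟦⟧₁ e ℓ f p = ≃-sym (extend₁-⟦⟧ e (f ∷ []) ℓ p)

extend₁-▶z : (f : Word₁ → Poly n) (p : Poly₁) → extend₁ (λ i → f i ▶z) p ≃ extend₁ f p ▶z
extend₁-▶z = extend₁-⟦⟧₁ (v0 ▷E 0 ⊕E v0 ▷E 1) (x ∷ y one ∷ [])

extend₁-▶φy : (s : Root n) (f : Word₁ → Poly n) (p : Poly₁) → extend₁ (λ i → f i ▶φy[ s ]) p ≃ extend₁ f p ▶φy[ s ]
extend₁-▶φy s f p = ≃-trans (extend₁-ext p (λ i → ≡⇒≃ (▶φy≡⟦⟧ s (f i))))
  (≃-trans (extend₁-⟦⟧₁ (φyₑ s) (x ∷ y one ∷ y s ∷ []) f p) (≡⇒≃ (sym (▶φy≡⟦⟧ s (extend₁ f p)))))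

-- φ and ψ_s on A₁

shift : Word n → Poly n → Poly n
shift u Q = map (λ { (d , w) → (d , u ·w w) }) Q

⊗≡extend : (P Q : Poly n) → P ⊗ Q ≡ extend (λ u → shift u Q) P
⊗≡extend []            Q = refl
⊗≡extend ((c , u) ∷ P) Q = cong₂ _++_ (scaled-shift Q) (⊗≡extend P Q)
  where
  scaled-shift : ∀ Q → map (λ { (d , w) → (c *ℚ d , u ·w w) }) Q ≡ c ⊛ shift u Q
  scaled-shift []            = refl
  scaled-shift ((d , w) ∷ Q) = cong ((c *ℚ d , u ·w w) ∷_) (scaled-shift Q)

⊗-as-⟦⟧ : (e : Expr) (ℓ : List (Letter n)) (Q : Poly n) → (∀ u → shift u Q ≡ ⟦ e ⟧ (mon u ∷ []) ℓ) →
          ∀ P → P ⊗ Q ≃ ⟦ e ⟧ (P ∷ []) ℓ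
⊗-as-⟦⟧ e ℓ Q shift≡ P =
  ≃-trans (≡⇒≃ (⊗≡extend P Q)) (≃-trans (extend-ext P (λ u → ≡⇒≃ (shift≡ u)))
    (≃-trans (≃-sym (extend-⟦⟧ e (mon ∷ []) ℓ P)) (⟦⟧-cong e ℓ (extend-mon P ∷ []))))

⊗φx : (P : Poly n) → P ⊗ φL x ≃ P ▶z
⊗φx = ⊗-as-⟦⟧ (v0 ▷E 0 ⊕E v0 ▷E 1) (x ∷ y one ∷ []) (φL x) (λ u → refl)

⊗φy : (s : Root n) (P : Poly n) → P ⊗ φL (y s) ≃ P ▶φy[ s ]
⊗φy {n} fzero = ⊗-as-⟦⟧ (φyₑ {n} fzero) (x ∷ y one ∷ y fzero ∷ []) (φL (y fzero)) (λ u → refl)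
⊗φy (fsuc k) = ⊗-as-⟦⟧ (φyₑ (fsuc k)) (x ∷ y one ∷ y (fsuc k) ∷ []) (φL (y (fsuc k))) (λ u → refl)

-- φ restricted to A₁, which it preserves
φ₁ : Word₁ → Poly₁
φ₁ ε₁        = mon₁ ε₁
φ₁ (v ▷₁ x₁) = φ₁ v ▶₁z
φ₁ (v ▷₁ y₁) = ⊝₁ (φ₁ v ▶₁ y₁)

φW-ι : (v : Word₁) → φW {n} (ιW v) ≃ ι (φ₁ v)
φW-ι ε₁        = ≃-refl
φW-ι (v ▷₁ x₁) = ≃-trans (⊗φx (φW (ιW v))) (≃-trans (▶z-cong (φW-ι v)) (≡⇒≃ (sym (ι-▶z (φ₁ v)))))
φW-ι (v ▷₁ y₁) = ≃-trans (⊗φy one (φW (ιW v))) (≃-trans (⊝-cong (▶-cong (y one) (φW-ι v)))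
  (≡⇒≃ (sym (trans (ι-scale (- 1ℚ) (φ₁ v ▶₁ y₁)) (cong ⊝_ (ι-▶ (φ₁ v) y₁))))))

module BaseCase {n : ℕ} (s : Root n) where

  -- On A₁, the maps 𝓘 and M_s just replace every y by y_s.
  σ : Word₁ → Word n
  σ ε₁        = ε
  σ (w ▷₁ x₁) = σ w ▷ x
  σ (w ▷₁ y₁) = σ w ▷ y s

  yprod-ι : ∀ ω → yprod {n} (ιW ω) ≡ one
  yprod-ι ε₁        = refl
  yprod-ι (ω ▷₁ x₁) = yprod-ι ω
  yprod-ι (ω ▷₁ y₁) = cong (_⊙ one) (yprod-ι ω)

  MW-ι-without-y : ∀ ω → hasY {n} (ιW ω) ≡ false → MW s (ιW ω) ≡ ιW ω
  MW-ι-without-y ε₁        _ = refl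
  MW-ι-without-y (ω ▷₁ x₁) h = cong (_▷ x) (MW-ι-without-y ω h)

  𝓘W-MW-ι : ∀ ω → 𝓘W (MW s (ιW ω)) ≡ σ ω × yprod (MW s (ιW ω)) ≡ (if hasY (ιW {n} ω) then s else one)
  𝓘W-MW-ι ε₁        = refl , refl
  𝓘W-MW-ι (ω ▷₁ x₁) = cong (_▷ x) (proj₁ (𝓘W-MW-ι ω)) , proj₂ (𝓘W-MW-ι ω)
  𝓘W-MW-ι (ω ▷₁ y₁) with hasY (ιW {n} ω) in has-y | 𝓘W-MW-ι ω
  ... | true  | 𝓘≡σ , yprod≡s = cong₂ (λ w t → w ▷ y t) 𝓘≡σ s⊙1≡s , s⊙1≡s
    where s⊙1≡s = trans (cong (_⊙ one) yprod≡s) (⊙-identityʳ s)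
  ... | false | 𝓘≡σ , _ =
    cong₂ (λ w t → w ▷ y t) (trans (cong 𝓘W (sym (MW-ι-without-y ω has-y))) 𝓘≡σ) 1⊙s⊙1≡s , 1⊙s⊙1≡s
    where
    1⊙s⊙1≡s : yprod (ιW ω) ⊙ (s ⊙ one) ≡ s
    1⊙s⊙1≡s = trans (cong (_⊙ (s ⊙ one)) (yprod-ι ω)) (trans (⊙-identityˡ (s ⊙ one)) (⊙-identityʳ s))

  gM g𝓘 : Word n → Poly n
  gM w = mon (MW s w)
  g𝓘 w = mon (𝓘W w)

  ψ≡extend : (P : Poly n) → ψ s P ≡ extend φW (extend g𝓘 (extend gM P))
  ψ≡extend P = trans (lin≡extend φW (𝓘 (M s P)))
    (cong (extend φW) (trans (lin≡extend g𝓘 (M s P)) (cong (extend g𝓘) (lin≡extend gM P))))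

  ψ-cong : {P Q : Poly n} → P ≃ Q → ψ s P ≃ ψ s Q
  ψ-cong {P} {Q} e = ≃-trans (≡⇒≃ (ψ≡extend P))
    (≃-trans (extend-cong φW (extend-cong g𝓘 (extend-cong gM e))) (≡⇒≃ (sym (ψ≡extend Q))))

  φσ : Word₁ → Poly n
  φσ ω = φW (σ ω)

  ψ-ι : (p : Poly₁) → ψ s (ι p) ≃ extend₁ φσ p
  ψ-ι p = begin
    ψ s (ι p)                                                        ≡⟨ ψ≡extend (ι p) ⟩
    extend φW (extend g𝓘 (extend gM (ι p)))                          ≡⟨ cong (λ P → extend φW (extend g𝓘 P)) (extend-ι gM p) ⟩
    extend φW (extend g𝓘 (extend₁ (λ ω → gM (ιW ω)) p))              ≈⟨ extend-cong φW (extend-extend₁ g𝓘 _ p) ⟩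
    extend φW (extend₁ (λ ω → extend g𝓘 (gM (ιW ω))) p)              ≈⟨ extend-extend₁ φW _ p ⟩
    extend₁ (λ ω → extend φW (extend g𝓘 (gM (ιW ω)))) p              ≈⟨ extend₁-ext p on-words ⟩
    extend₁ φσ p                                                     ∎
    where
    open SetoidReasoning ≃-setoid
    on-words : ∀ ω → extend φW (extend g𝓘 (gM (ιW ω))) ≃ φσ ω
    on-words ω = ≃-trans (extend-cong φW (extend-single g𝓘 (MW s (ιW ω))))
                   (≃-trans (extend-single φW (𝓘W (MW s (ιW ω)))) (≡⇒≃ (cong φW (proj₁ (𝓘W-MW-ι ω)))))

  -- ψ_s φ(v) = v ⋄_s 1; on A₁ it is φ σ φ(v), multiplicative in v.
  ψφ : Word₁ → Poly n
  ψφ v = extend₁ φσ (φ₁ v)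

  base≃ψφ : ∀ v → base s v ≃ ψφ v
  base≃ψφ v = ≃-trans (ψ-cong (≃-trans (extend-single φW (ιW v)) (φW-ι v))) (ψ-ι (φ₁ v))

  ψφ-▷y : ∀ v → ψφ (v ▷₁ y₁) ≃ ⊝ (ψφ v ▶φy[ s ])
  ψφ-▷y v = ≃-trans (extend₁-scale φσ (- 1ℚ) (φ₁ v ▶₁ y₁)) (⊝-cong (φσ-▷y (φ₁ v)))
    where
    φσ-▷y : ∀ p → extend₁ φσ (p ▶₁ y₁) ≃ extend₁ φσ p ▶φy[ s ]
    φσ-▷y p = ≃-trans (≡⇒≃ (extend₁-▶-keys φσ p y₁))
                (≃-trans (extend₁-ext p (λ ω → ⊗φy s (φσ ω))) (extend₁-▶φy s φσ p))

  ψφ-▷x : ∀ v → ψφ (v ▷₁ x₁) ≃ ψφ v ▶z ⊕ ψφ v ▶φy[ s ]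
  ψφ-▷x v = ≃-trans (extend₁-++ φσ (φ₁ v ▶₁ x₁) (φ₁ v ▶₁ y₁)) (⊕-cong
    (≃-trans (≡⇒≃ (extend₁-▶-keys φσ (φ₁ v) x₁)) (≃-trans (extend₁-ext (φ₁ v) (λ ω → ⊗φx (φσ ω))) (extend₁-▶z φσ (φ₁ v))))
    (≃-trans (≡⇒≃ (extend₁-▶-keys φσ (φ₁ v) y₁)) (≃-trans (extend₁-ext (φ₁ v) (λ ω → ⊗φy s (φσ ω))) (extend₁-▶φy s φσ (φ₁ v)))))

  ⋄W-ε : ∀ a → ⋄W s a ε ≃ ψφ a
  ⋄W-ε ε₁        = ≃-sym (extend₁-single φσ ε₁)
  ⋄W-ε (a ▷₁ x₁) = base≃ψφ (a ▷₁ x₁)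
  ⋄W-ε (a ▷₁ y₁) = base≃ψφ (a ▷₁ y₁)

  ⋄W-ε-▷y : ∀ a → ⋄W s (a ▷₁ y₁) ε ≃ ⊝ (⋄W s a ε ▶φy[ s ])
  ⋄W-ε-▷y a = ≃-trans (⋄W-ε (a ▷₁ y₁)) (≃-trans (ψφ-▷y a) (⊝-cong (▶φy-cong s (≃-sym (⋄W-ε a)))))

  ⋄W-ε-▷z : ∀ a → ⋄W s (a ▷₁ x₁) ε ⊕ ⋄W s (a ▷₁ y₁) ε ≃ ⋄W s a ε ▶z
  ⋄W-ε-▷z a = ≃-trans (⊕-cong (≃-trans (⋄W-ε (a ▷₁ x₁)) (ψφ-▷x a)) (≃-trans (⋄W-ε (a ▷₁ y₁)) (ψφ-▷y a)))
    (≃-trans (solveₑ ((v0 ⊕E v1) ⊕E ⊝E v1) v0 (ψφ a ▶z ∷ ψφ a ▶φy[ s ] ∷ []) [])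
             (▶z-cong (≃-sym (⋄W-ε a))))

-- Recursion laws of the diamond product on words

module WordLaws {n : ℕ} (s : Root n) where
  open BaseCase s using (⋄W-ε-▷z)

  private
    A : Word₁ → Word n → Poly n
    A = ⋄W s

    lin-mon : ∀ a u → lin (A a) (mon u) ≃ A a u
    lin-mon a u = ≃-trans (≡⇒≃ (lin≡extend (A a) (mon u))) (extend-single (A a) u)

  ⋄W-zˡ : ∀ a w → A (a ▷₁ x₁) w ⊕ A (a ▷₁ y₁) w ≃ A a w ▶z
  ⋄W-zˡ a ε = ⋄W-ε-▷z a
  ⋄W-zˡ a (w ▷ x) = ≃-trans
    (solveₑ ((v0 ▷E 0 ⊖E v1 ▷E 0) ⊕E (v0 ▷E 1 ⊕E v1 ▷E 0)) (v0 ▷E 0 ⊕E v0 ▷E 1)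
      (lin (A a) (mon (w ▷ x)) ∷ A (a ▷₁ y₁) w ∷ []) (x ∷ y one ∷ []))
    (▶z-cong (lin-mon a (w ▷ x)))
  ⋄W-zˡ a (w ▷ y fzero) = ≃-trans
    (solveₑ ((v0 ▷E 0 ⊕E v1 ▷E 1) ⊕E (v0 ▷E 1 ⊖E v1 ▷E 1)) (v0 ▷E 0 ⊕E v0 ▷E 1)
      (lin (A a) (mon (w ▷ y fzero)) ∷ A (a ▷₁ x₁) w ∷ []) (x ∷ y one ∷ []))
    (▶z-cong (lin-mon a (w ▷ y fzero)))
  ⋄W-zˡ a (w ▷ y (fsuc k)) = ≃-trans
    (solveₑ ((v0 ▷E 0 ⊕E v1 ▷E 2 ⊖E v2 ▷E 2) ⊕E (v0 ▷E 1 ⊖E v1 ▷E 2 ⊕E v2 ▷E 2)) (v0 ▷E 0 ⊕E v0 ▷E 1)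
      (lin (A a) (mon (w ▷ y (fsuc k))) ∷ lin (A a) (mon (w ▷ x) ⊕ mon (w ▷ y (fsuc k))) ∷ A (a ▷₁ y₁) w ∷ [])
      (x ∷ y one ∷ y (fsuc k) ∷ []))
    (▶z-cong (lin-mon a (w ▷ y (fsuc k))))

  ⋄W-xˡ : ∀ a w → A (a ▷₁ x₁) w ≃ A a w ▶z ⊖ A (a ▷₁ y₁) w
  ⋄W-xˡ a w = ≃-trans (solveₑ v0 ((v0 ⊕E v1) ⊖E v1) (A (a ▷₁ x₁) w ∷ A (a ▷₁ y₁) w ∷ []) [])
                      (⊖-cong (⋄W-zˡ a w) ≃-refl)

  ⋄W-zʳ : ∀ a w → A a (w ▷ x) ⊕ A a (w ▷ y one) ≃ A a w ▶z
  ⋄W-zʳ ε₁ w = ≃-refl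
  ⋄W-zʳ (a ▷₁ x₁) w = begin
    A (a ▷₁ x₁) (w ▷ x) ⊕ A (a ▷₁ x₁) (w ▷ y one)
      ≈⟨ rewriteₑ ((v0 ▷E 0 ⊖E v1 ▷E 0) ⊕E (v2 ▷E 0 ⊕E v3 ▷E 1)) es τ ℓ
                  (lin-mon a (w ▷ x) ∷ ≃-refl ∷ lin-mon a (w ▷ y one) ∷ ⋄W-xˡ a w ∷ []) ⟩
    ⟦ substitute ((v0 ▷E 0 ⊖E v1 ▷E 0) ⊕E (v2 ▷E 0 ⊕E v3 ▷E 1)) es ⟧ τ ℓ
      ≈⟨ solveₑ (substitute ((v0 ▷E 0 ⊖E v1 ▷E 0) ⊕E (v2 ▷E 0 ⊕E v3 ▷E 1)) es)
                ((v0 ⊕E v2) ▷E 0 ⊖E v1 ▷E 0 ⊕E v3 ▷E 0 ▷E 1 ⊕E v3 ▷E 1 ▷E 1 ⊖E v1 ▷E 1) τ ℓ ⟩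
    ⟦ (v0 ⊕E v2) ▷E 0 ⊖E v1 ▷E 0 ⊕E v3 ▷E 0 ▷E 1 ⊕E v3 ▷E 1 ▷E 1 ⊖E v1 ▷E 1 ⟧ τ ℓ
      ≈⟨ rewriteₑ e′ es′ τ′ ℓ (⋄W-zʳ a w ∷ ≃-refl ∷ ≃-refl ∷ []) ⟩
    ⟦ substitute e′ es′ ⟧ τ′ ℓ
      ≈⟨ solveₑ (substitute e′ es′) (((v1 ▷E 0 ⊕E v1 ▷E 1) ⊖E v0) ▷E 0 ⊕E ((v1 ▷E 0 ⊕E v1 ▷E 1) ⊖E v0) ▷E 1) τ′ ℓ ⟩
    (A a w ▶z ⊖ A (a ▷₁ y₁) w) ▶z
      ≈⟨ ▶z-cong (≃-sym (⋄W-xˡ a w)) ⟩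
    A (a ▷₁ x₁) w ▶z ∎
    where
    open SetoidReasoning ≃-setoid
    ℓ  = x ∷ y one ∷ []
    es = v0 ∷ v1 ∷ v2 ∷ ((v3 ▷E 0 ⊕E v3 ▷E 1) ⊖E v1) ∷ []
    τ  = A a (w ▷ x) ∷ A (a ▷₁ y₁) w ∷ A a (w ▷ y one) ∷ A a w ∷ []
    e′ = v0 ▷E 0 ⊖E v1 ▷E 0 ⊕E v2 ▷E 0 ▷E 1 ⊕E v2 ▷E 1 ▷E 1 ⊖E v1 ▷E 1
    es′ = (v1 ▷E 0 ⊕E v1 ▷E 1) ∷ v0 ∷ v1 ∷ []
    τ′ = A (a ▷₁ y₁) w ∷ A a w ∷ []
  ⋄W-zʳ (a ▷₁ y₁) w = begin
    A (a ▷₁ y₁) (w ▷ x) ⊕ A (a ▷₁ y₁) (w ▷ y one)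
      ≈⟨ rewriteₑ e es τ ℓ (lin-mon a (w ▷ x) ∷ ≃-refl ∷ lin-mon a (w ▷ y one) ∷ ⋄W-xˡ a w ∷ []) ⟩
    ⟦ substitute e es ⟧ τ ℓ
      ≈⟨ solveₑ (substitute e es) ((v0 ⊕E v2) ▷E 1 ⊕E v1 ▷E 0 ⊖E v3 ▷E 0 ▷E 1 ⊖E v3 ▷E 1 ▷E 1 ⊕E v1 ▷E 1) τ ℓ ⟩
    ⟦ (v0 ⊕E v2) ▷E 1 ⊕E v1 ▷E 0 ⊖E v3 ▷E 0 ▷E 1 ⊖E v3 ▷E 1 ▷E 1 ⊕E v1 ▷E 1 ⟧ τ ℓ
      ≈⟨ rewriteₑ e′ es′ τ′ ℓ (⋄W-zʳ a w ∷ ≃-refl ∷ ≃-refl ∷ []) ⟩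
    ⟦ substitute e′ es′ ⟧ τ′ ℓ
      ≈⟨ solveₑ (substitute e′ es′) (v0 ▷E 0 ⊕E v0 ▷E 1) τ′ ℓ ⟩
    A (a ▷₁ y₁) w ▶z ∎
    where
    open SetoidReasoning ≃-setoid
    ℓ  = x ∷ y one ∷ []
    e  = (v0 ▷E 1 ⊕E v1 ▷E 0) ⊕E (v2 ▷E 1 ⊖E v3 ▷E 1)
    es = v0 ∷ v1 ∷ v2 ∷ ((v3 ▷E 0 ⊕E v3 ▷E 1) ⊖E v1) ∷ []
    τ  = A a (w ▷ x) ∷ A (a ▷₁ y₁) w ∷ A a (w ▷ y one) ∷ A a w ∷ []
    e′ = v0 ▷E 1 ⊕E v1 ▷E 0 ⊖E v2 ▷E 0 ▷E 1 ⊖E v2 ▷E 1 ▷E 1 ⊕E v1 ▷E 1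
    es′ = (v1 ▷E 0 ⊕E v1 ▷E 1) ∷ v0 ∷ v1 ∷ []
    τ′ = A (a ▷₁ y₁) w ∷ A a w ∷ []

  ⋄W-y-y : ∀ a w → A (a ▷₁ y₁) (w ▷ y one) ≃
    A a (w ▷ y one) ▶ y one ⊖ A a w ▶ x ▶ y one ⊖ A a w ▶ y one ▶ y one ⊕ A (a ▷₁ y₁) w ▶ y one
  ⋄W-y-y a w = ≃-trans (rewriteₑ e es τ ℓ (lin-mon a (w ▷ y one) ∷ ⋄W-xˡ a w ∷ []))
    (solveₑ (substitute e es) (v0 ▷E 1 ⊖E v1 ▷E 0 ▷E 1 ⊖E v1 ▷E 1 ▷E 1 ⊕E v2 ▷E 1) τ ℓ)
    where
    ℓ  = x ∷ y one ∷ []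
    e  = v0 ▷E 1 ⊖E v1 ▷E 1
    es = v0 ∷ ((v1 ▷E 0 ⊕E v1 ▷E 1) ⊖E v2) ∷ []
    τ  = A a (w ▷ y one) ∷ A a w ∷ A (a ▷₁ y₁) w ∷ []

  ⋄W-y-zt : ∀ a k w → A (a ▷₁ y₁) (w ▷ x) ⊕ A (a ▷₁ y₁) (w ▷ y (fsuc k)) ≃
    (A a (w ▷ x) ⊕ A a (w ▷ y (fsuc k))) ▶y−y[ fsuc k ] ⊕ A (a ▷₁ y₁) w ▶z[ fsuc k ]
  ⋄W-y-zt a k w = ≃-trans
    (rewriteₑ e es τ ℓ (lin-mon a (w ▷ x) ∷ ≃-refl ∷ lin-mon a (w ▷ y t) ∷
       ≃-trans (≃-trans (≡⇒≃ (lin≡extend (A a) (mon (w ▷ x) ⊕ mon (w ▷ y t)))) (extend-++ (A a) (mon (w ▷ x)) (mon (w ▷ y t))))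
               (⊕-cong (extend-single (A a) (w ▷ x)) (extend-single (A a) (w ▷ y t))) ∷ []))
    (solveₑ (substitute e es) ((v0 ⊕E v2) ▷E 1 ⊖E (v0 ⊕E v2) ▷E 2 ⊕E (v1 ▷E 0 ⊕E v1 ▷E 2)) τ ℓ)
    where
    t  = fsuc k
    ℓ  = x ∷ y one ∷ y t ∷ []
    e  = (v0 ▷E 1 ⊕E v1 ▷E 0) ⊕E (v2 ▷E 1 ⊖E v3 ▷E 2 ⊕E v1 ▷E 2)
    es = v0 ∷ v1 ∷ v2 ∷ (v0 ⊕E v2) ∷ []
    τ  = A a (w ▷ x) ∷ A (a ▷₁ y₁) w ∷ A a (w ▷ y t) ∷ []

_⋄ʷ[_]_ : Word₁ → Root n → Poly n → Poly n
a ⋄ʷ[ s ] W = extend (⋄W s a) W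

_⋄[_]_ : Poly₁ → Root n → Poly n → Poly n
p ⋄[ s ] W = extend₁ (λ a → a ⋄ʷ[ s ] W) p

infixr 25 _⋄ʷ[_]_ _⋄[_]_

module WordDiamond {n : ℕ} (s : Root n) where
  open WordLaws s

  private
    A : Word₁ → Word n → Poly n
    A = ⋄W s

  ⋄ʷ-▶z-split : ∀ t a W → a ⋄ʷ[ s ] (W ▶z[ t ]) ≃ extend (λ w → A a (w ▷ x)) W ⊕ extend (λ w → A a (w ▷ y t)) W
  ⋄ʷ-▶z-split t a W = ≃-trans (extend-++ (A a) (W ▶ x) (W ▶ y t))
    (≡⇒≃ (cong₂ _⊕_ (extend-▶-keys (A a) W x) (extend-▶-keys (A a) W (y t))))

  ⋄ʷ-zˡ : ∀ a W → (a ▷₁ x₁) ⋄ʷ[ s ] W ⊕ (a ▷₁ y₁) ⋄ʷ[ s ] W ≃ a ⋄ʷ[ s ] W ▶z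
  ⋄ʷ-zˡ a = extend-identity (v0 ⊕E v1) (v0 ▷E 0 ⊕E v0 ▷E 1) (A (a ▷₁ x₁) ∷ A (a ▷₁ y₁) ∷ []) (A a ∷ [])
                            (x ∷ y one ∷ []) (⋄W-zˡ a)

  ⋄ʷ-zʳ : ∀ a W → a ⋄ʷ[ s ] (W ▶z) ≃ a ⋄ʷ[ s ] W ▶z
  ⋄ʷ-zʳ a W = ≃-trans (⋄ʷ-▶z-split one a W)
    (extend-identity (v0 ⊕E v1) (v0 ▷E 0 ⊕E v0 ▷E 1) ((λ w → A a (w ▷ x)) ∷ (λ w → A a (w ▷ y one)) ∷ []) (A a ∷ [])
                     (x ∷ y one ∷ []) (⋄W-zʳ a) W)

  ⋄ʷ-y-y : ∀ a W → (a ▷₁ y₁) ⋄ʷ[ s ] (W ▶ y one) ≃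
    a ⋄ʷ[ s ] (W ▶ y one) ▶ y one ⊖ a ⋄ʷ[ s ] W ▶ x ▶ y one ⊖ a ⋄ʷ[ s ] W ▶ y one ▶ y one ⊕ (a ▷₁ y₁) ⋄ʷ[ s ] W ▶ y one
  ⋄ʷ-y-y a W = ≃-trans (≡⇒≃ (extend-▶-keys (A (a ▷₁ y₁)) W (y one)))
    (≃-trans (extend-identity v0 (v0 ▷E 1 ⊖E v1 ▷E 0 ▷E 1 ⊖E v1 ▷E 1 ▷E 1 ⊕E v2 ▷E 1)
                ((λ w → A (a ▷₁ y₁) (w ▷ y one)) ∷ []) ((λ w → A a (w ▷ y one)) ∷ A a ∷ A (a ▷₁ y₁) ∷ [])
                (x ∷ y one ∷ []) (⋄W-y-y a) W)
    (≡⇒≃ (cong (λ U → U ▶ y one ⊖ a ⋄ʷ[ s ] W ▶ x ▶ y one ⊖ a ⋄ʷ[ s ] W ▶ y one ▶ y one ⊕ (a ▷₁ y₁) ⋄ʷ[ s ] W ▶ y one)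
               (sym (extend-▶-keys (A a) W (y one))))))

  ⋄ʷ-y-zt : ∀ a k W → (a ▷₁ y₁) ⋄ʷ[ s ] (W ▶z[ fsuc k ]) ≃
    a ⋄ʷ[ s ] (W ▶z[ fsuc k ]) ▶y−y[ fsuc k ] ⊕ (a ▷₁ y₁) ⋄ʷ[ s ] W ▶z[ fsuc k ]
  ⋄ʷ-y-zt a k W = ≃-trans (⋄ʷ-▶z-split t (a ▷₁ y₁) W)
    (≃-trans (extend-identity (v0 ⊕E v1) ((v0 ⊕E v1) ▷E 1 ⊖E (v0 ⊕E v1) ▷E 2 ⊕E (v2 ▷E 0 ⊕E v2 ▷E 2))
                ((λ w → A (a ▷₁ y₁) (w ▷ x)) ∷ (λ w → A (a ▷₁ y₁) (w ▷ y t)) ∷ [])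
                ((λ w → A a (w ▷ x)) ∷ (λ w → A a (w ▷ y t)) ∷ A (a ▷₁ y₁) ∷ [])
                (x ∷ y one ∷ y t ∷ []) (⋄W-y-zt a k) W)
    (⊕-cong (▶y−y-cong t (≃-sym (⋄ʷ-▶z-split t a W))) ≃-refl))
    where t = fsuc k

  ⋄ʷ-y-ε : ∀ a → (a ▷₁ y₁) ⋄ʷ[ s ] mon ε ≃ ⊝ (a ⋄ʷ[ s ] mon ε ▶φy[ s ])
  ⋄ʷ-y-ε a = ≃-trans (extend-single (A (a ▷₁ y₁)) ε)
    (≃-trans (BaseCase.⋄W-ε-▷y s a) (⊝-cong (▶φy-cong s (≃-sym (extend-single (A a) ε)))))

module PolyDiamond {n : ℕ} (s : Root n) where
  open WordDiamond s

  ⋄-congˡ : ∀ {p q} W → p ≃₁ q → p ⋄[ s ] W ≃ q ⋄[ s ] W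
  ⋄-congˡ W = extend₁-cong (λ a → a ⋄ʷ[ s ] W)

  ⋄-++ˡ : ∀ p q W → (p ++ q) ⋄[ s ] W ≃ p ⋄[ s ] W ⊕ q ⋄[ s ] W
  ⋄-++ˡ p q W = extend₁-++ (λ a → a ⋄ʷ[ s ] W) p q

  ⋄-scaleˡ : ∀ c p W → Sums₁.scale c p ⋄[ s ] W ≃ c ⊛ p ⋄[ s ] W
  ⋄-scaleˡ c p W = extend₁-scale (λ a → a ⋄ʷ[ s ] W) c p

  ⋄-mon₁ : ∀ a W → mon₁ a ⋄[ s ] W ≃ a ⋄ʷ[ s ] W
  ⋄-mon₁ a W = extend₁-single (λ a → a ⋄ʷ[ s ] W) a

  ⋄-identityˡ : ∀ W → mon₁ ε₁ ⋄[ s ] W ≃ W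
  ⋄-identityˡ W = ≃-trans (⋄-mon₁ ε₁ W) (extend-mon W)

  ⋄-congʳ : ∀ p {W W′} → W ≃ W′ → p ⋄[ s ] W ≃ p ⋄[ s ] W′
  ⋄-congʳ p e = extend₁-ext p (λ a → extend-cong (⋄W s a) e)

  ⋄-⊕ʳ : ∀ p W W′ → p ⋄[ s ] (W ⊕ W′) ≃ p ⋄[ s ] W ⊕ p ⋄[ s ] W′
  ⋄-⊕ʳ p W W′ = ≃-trans (extend₁-ext p (λ a → extend-++ (⋄W s a) W W′)) (≃-sym (extend₁-⊕ _ _ p))

  ⋄-⊛ʳ : ∀ p c W → p ⋄[ s ] (c ⊛ W) ≃ c ⊛ p ⋄[ s ] W
  ⋄-⊛ʳ p c W = ≃-trans (extend₁-ext p (λ a → extend-⊛-keys (⋄W s a) c W)) (≃-sym (extend₁-⊛ c _ p))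

  ⋄-⊝ʳ : ∀ p W → p ⋄[ s ] (⊝ W) ≃ ⊝ p ⋄[ s ] W
  ⋄-⊝ʳ p = ⋄-⊛ʳ p (- 1ℚ)

  ⋄-nilʳ : ∀ p → p ⋄[ s ] [] ≃ []
  ⋄-nilʳ p = ≃-sym (extend₁-zero p)

  ⋄-zˡ : ∀ p W → (p ▶₁z) ⋄[ s ] W ≃ p ⋄[ s ] W ▶z
  ⋄-zˡ p W = ≃-trans (⋄-++ˡ (p ▶₁ x₁) (p ▶₁ y₁) W)
    (≃-trans (≡⇒≃ (cong₂ _⊕_ (extend₁-▶-keys (λ a → a ⋄ʷ[ s ] W) p x₁) (extend₁-▶-keys (λ a → a ⋄ʷ[ s ] W) p y₁)))
      (extend₁-identity (v0 ⊕E v1) (v0 ▷E 0 ⊕E v0 ▷E 1)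
        ((λ a → (a ▷₁ x₁) ⋄ʷ[ s ] W) ∷ (λ a → (a ▷₁ y₁) ⋄ʷ[ s ] W) ∷ []) ((λ a → a ⋄ʷ[ s ] W) ∷ [])
        (x ∷ y one ∷ []) (λ a → ⋄ʷ-zˡ a W) p))

  ⋄-zʳ : ∀ p W → p ⋄[ s ] (W ▶z) ≃ p ⋄[ s ] W ▶z
  ⋄-zʳ p W = extend₁-identity v0 (v0 ▷E 0 ⊕E v0 ▷E 1) ((λ a → a ⋄ʷ[ s ] (W ▶z)) ∷ []) ((λ a → a ⋄ʷ[ s ] W) ∷ [])
    (x ∷ y one ∷ []) (λ a → ⋄ʷ-zʳ a W) p

  ⋄-y-y : ∀ p W → (p ▶₁ y₁) ⋄[ s ] (W ▶ y one) ≃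
    p ⋄[ s ] (W ▶ y one) ▶ y one ⊖ p ⋄[ s ] W ▶ x ▶ y one ⊖ p ⋄[ s ] W ▶ y one ▶ y one ⊕ (p ▶₁ y₁) ⋄[ s ] W ▶ y one
  ⋄-y-y p W = ≃-trans (≡⇒≃ (extend₁-▶-keys (λ a → a ⋄ʷ[ s ] (W ▶ y one)) p y₁))
    (≃-trans (extend₁-identity v0 (v0 ▷E 1 ⊖E v1 ▷E 0 ▷E 1 ⊖E v1 ▷E 1 ▷E 1 ⊕E v2 ▷E 1)
               ((λ a → (a ▷₁ y₁) ⋄ʷ[ s ] (W ▶ y one)) ∷ [])
               ((λ a → a ⋄ʷ[ s ] (W ▶ y one)) ∷ (λ a → a ⋄ʷ[ s ] W) ∷ (λ a → (a ▷₁ y₁) ⋄ʷ[ s ] W) ∷ [])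
               (x ∷ y one ∷ []) (λ a → ⋄ʷ-y-y a W) p)
    (≡⇒≃ (cong (λ U → p ⋄[ s ] (W ▶ y one) ▶ y one ⊖ p ⋄[ s ] W ▶ x ▶ y one ⊖ p ⋄[ s ] W ▶ y one ▶ y one ⊕ U ▶ y one)
               (sym (extend₁-▶-keys (λ a → a ⋄ʷ[ s ] W) p y₁)))))

  ⋄-y-zt : ∀ p k W → (p ▶₁ y₁) ⋄[ s ] (W ▶z[ fsuc k ]) ≃
    p ⋄[ s ] (W ▶z[ fsuc k ]) ▶y−y[ fsuc k ] ⊕ (p ▶₁ y₁) ⋄[ s ] W ▶z[ fsuc k ]
  ⋄-y-zt p k W = ≃-trans (≡⇒≃ (extend₁-▶-keys (λ a → a ⋄ʷ[ s ] (W ▶z[ t ])) p y₁))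
    (≃-trans (extend₁-identity v0 (v0 ▷E 1 ⊖E v0 ▷E 2 ⊕E (v1 ▷E 0 ⊕E v1 ▷E 2))
               ((λ a → (a ▷₁ y₁) ⋄ʷ[ s ] (W ▶z[ t ])) ∷ []) ((λ a → a ⋄ʷ[ s ] (W ▶z[ t ])) ∷ (λ a → (a ▷₁ y₁) ⋄ʷ[ s ] W) ∷ [])
               (x ∷ y one ∷ y t ∷ []) (λ a → ⋄ʷ-y-zt a k W) p)
    (≡⇒≃ (cong (λ U → p ⋄[ s ] (W ▶z[ t ]) ▶y−y[ t ] ⊕ U ▶z[ t ]) (sym (extend₁-▶-keys (λ a → a ⋄ʷ[ s ] W) p y₁)))))
    where t = fsuc k

  ⋄-y-ε : ∀ p → (p ▶₁ y₁) ⋄[ s ] mon ε ≃ ⊝ (p ⋄[ s ] mon ε ▶φy[ s ])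
  ⋄-y-ε p = ≃-trans (≡⇒≃ (extend₁-▶-keys (λ a → a ⋄ʷ[ s ] mon ε) p y₁))
    (≃-trans (extend₁-ext p ⋄ʷ-y-ε)
    (≃-trans (≃-sym (extend₁-⊛ (- 1ℚ) (λ a → a ⋄ʷ[ s ] mon ε ▶φy[ s ]) p))
             (⊝-cong (extend₁-▶φy s (λ a → a ⋄ʷ[ s ] mon ε) p))))

toWord₁-ιW : (u : Word₁) → toWord₁ {n} (ιW u) ≡ just u
toWord₁-ιW ε₁ = refl
toWord₁-ιW {n} (u ▷₁ x₁) rewrite toWord₁-ιW {n} u = refl
toWord₁-ιW {n} (u ▷₁ y₁) rewrite toWord₁-ιW {n} u = refl

toWord₁-just : (w : Word n) {u : Word₁} → toWord₁ w ≡ just u → w ≡ ιW u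
toWord₁-just ε refl = refl
toWord₁-just (w ▷ x) e with toWord₁ w in eq
toWord₁-just (w ▷ x) refl | just u = cong (_▷ x) (toWord₁-just w eq)
toWord₁-just (w ▷ y fzero) e with toWord₁ w in eq
toWord₁-just (w ▷ y fzero) refl | just u = cong (_▷ y fzero) (toWord₁-just w eq)

ιW-injective : (u v : Word₁) → ιW {n} u ≡ ιW v → u ≡ v
ιW-injective u v e = just-injective (trans (sym (toWord₁-ιW u)) (trans (cong toWord₁ e) (toWord₁-ιW v)))

does-ιW : (u v : Word₁) → does (u ≟W₁ v) ≡ does (ιW {n} u ≟W ιW v)
does-ιW {n} u v with u ≟W₁ v
... | yes refl = sym (dec-true (ιW u ≟W ιW u) refl)
... | no u≢v   = sym (dec-false (ιW {n} u ≟W ιW v) (λ e → u≢v (ιW-injective u v e)))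

coeffOf-ρ : (P : Poly n) (u : Word₁) → Sums₁.coeffOf (ρ P) u ≡ coeffOf P (ιW u)
coeffOf-ρ []            u = refl
coeffOf-ρ ((c , w) ∷ P) u with toWord₁ w in eq
... | just u′ rewrite toWord₁-just w eq =
  cong₂ _+ℚ_ (cong (λ b → if b then c else 0ℚ) (does-ιW u′ u)) (coeffOf-ρ P u)
... | nothing = trans (coeffOf-ρ P u) (sym (trans (cong (λ b → (if b then c else 0ℚ) +ℚ coeffOf P (ιW u)) w≢ιu) (ℚ.+-identityˡ _)))
  where
  w≢ιu : does (w ≟W ιW u) ≡ false
  w≢ιu = dec-false (w ≟W ιW u) λ { refl → case trans (sym eq) (toWord₁-ιW u) of λ () }

ρ-cong : {P Q : Poly n} → P ≃ Q → ρ P ≃₁ ρ Q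
ρ-cong {P = P} {Q} e = coeffwise₁ λ u → trans (coeffOf-ρ P u) (trans (at e (ιW u)) (sym (coeffOf-ρ Q u)))

ρ-++ : (P Q : Poly n) → ρ (P ++ Q) ≡ ρ P ++ ρ Q
ρ-++ []            Q = refl
ρ-++ ((c , w) ∷ P) Q with toWord₁ w
... | just u  = cong ((c , u) ∷_) (ρ-++ P Q)
... | nothing = ρ-++ P Q

ρ-⊛ : (c : ℚ) (P : Poly n) → ρ (c ⊛ P) ≡ Sums₁.scale c (ρ P)
ρ-⊛ c []            = refl
ρ-⊛ c ((d , w) ∷ P) with toWord₁ w
... | just u  = cong ((c *ℚ d , u) ∷_) (ρ-⊛ c P)
... | nothing = ρ-⊛ c P

ρ-▶ : (P : Poly n) (a : Letter₁) → ρ (P ▶ ιL a) ≡ ρ P ▶₁ a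
ρ-▶ []            a  = refl
ρ-▶ ((c , w) ∷ P) x₁ with toWord₁ w
... | just u  = cong ((c , u ▷₁ x₁) ∷_) (ρ-▶ P x₁)
... | nothing = ρ-▶ P x₁
ρ-▶ ((c , w) ∷ P) y₁ with toWord₁ w
... | just u  = cong ((c , u ▷₁ y₁) ∷_) (ρ-▶ P y₁)
... | nothing = ρ-▶ P y₁

ρ-ι : (q : Poly₁) → ρ {n} (ι q) ≡ q
ρ-ι []                = refl
ρ-ι {n} ((c , u) ∷ q) rewrite toWord₁-ιW {n} u = cong ((c , u) ∷_) (ρ-ι q)

ρ-▶z : (P : Poly n) → ρ (P ▶z) ≡ ρ P ▶₁z
ρ-▶z P = trans (ρ-++ (P ▶ x) (P ▶ y one)) (cong₂ _++_ (ρ-▶ P x₁) (ρ-▶ P y₁))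

-- The product ⋄₁ on A₁

cons≃scale-mon₁ : (c : ℚ) (a : Word₁) (p : Poly₁) → (c , a) ∷ p ≃₁ Sums₁.scale c (mon₁ a) ++ p
cons≃scale-mon₁ c a p = coeffwise₁ λ u → cong (_+ℚ Sums₁.coeffOf p u) (c≡c*1 (does (a ≟W₁ u)))
  where
  c≡c*1 : ∀ b → (if b then c else 0ℚ) ≡ (if b then c *ℚ 1ℚ else 0ℚ)
  c≡c*1 true  = sym (ℚ.*-identityʳ c)
  c≡c*1 false = refl

mon₁-▷x : (a : Word₁) → mon₁ (a ▷₁ x₁) ≃₁ mon₁ a ▶₁z ++ Sums₁.scale (- 1ℚ) (mon₁ (a ▷₁ y₁))
mon₁-▷x a = coeffwise₁ λ u → cancel (does ((a ▷₁ x₁) ≟W₁ u)) (does ((a ▷₁ y₁) ≟W₁ u))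
  where
  cancel : ∀ b b′ → (if b then 1ℚ else 0ℚ) +ℚ 0ℚ ≡
    (if b then 1ℚ else 0ℚ) +ℚ ((if b′ then 1ℚ else 0ℚ) +ℚ ((if b′ then (- 1ℚ) *ℚ 1ℚ else 0ℚ) +ℚ 0ℚ))
  cancel true  true  = refl
  cancel true  false = refl
  cancel false true  = refl
  cancel false false = refl

word-induction : (K : Poly₁ → Set) → (∀ {p p′} → p ≃₁ p′ → K p → K p′) →
  (∀ {p p′} → K p → K p′ → K (p ++ p′)) → (∀ c {p} → K p → K (Sums₁.scale c p)) →
  K (mon₁ ε₁) → (∀ a → K (mon₁ a) → K (mon₁ a ▶₁z)) → (∀ a → K (mon₁ a) → K (mon₁ (a ▷₁ y₁))) →
  ∀ a → K (mon₁ a)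
word-induction K resp ++-closed scale-closed base z-step y-step = go
  where
  go : ∀ a → K (mon₁ a)
  go ε₁        = base
  go (a ▷₁ y₁) = y-step a (go a)
  go (a ▷₁ x₁) = resp (≃₁-sym (mon₁-▷x a)) (++-closed (z-step a (go a)) (scale-closed (- 1ℚ) (y-step a (go a))))

module Product₁ (n : ℕ) where
  open PolyDiamond {n} one

  _⋆_ : Poly₁ → Poly₁ → Poly₁
  p ⋆ q = ρ (p ⋄[ one {n} ] ι q)

  infixl 30 _⋆_

  ⋆-identityˡ : ∀ q → mon₁ ε₁ ⋆ q ≃₁ q
  ⋆-identityˡ q = ≃₁-trans (ρ-cong (⋄-identityˡ (ι q))) (≡⇒≃₁ (ρ-ι q))

  ⋄ʷ-ε-▷y : ∀ a → a ⋄ʷ[ one ] mon ε ≃ mon (ιW {n} a) → (a ▷₁ y₁) ⋄ʷ[ one ] mon ε ≃ mon (ιW (a ▷₁ y₁))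
  ⋄ʷ-ε-▷y a h = ≃-trans (WordDiamond.⋄ʷ-y-ε one a) (≃-trans (⊝-cong (⊝-cong (▶-cong (y one) h)))
                  (solveₑ (⊝E (⊝E (v0 ▷E 0))) (v0 ▷E 0) (mon (ιW a) ∷ []) (y one ∷ [])))

  ⋄ʷ-ε : ∀ a → a ⋄ʷ[ one ] mon ε ≃ mon (ιW {n} a)
  ⋄ʷ-ε ε₁        = extend-single (⋄W one ε₁) ε
  ⋄ʷ-ε (a ▷₁ y₁) = ⋄ʷ-ε-▷y a (⋄ʷ-ε a)
  ⋄ʷ-ε (a ▷₁ x₁) = begin
    (a ▷₁ x₁) ⋄ʷ[ one ] mon ε                                          ≈⟨ solveₑ v0 ((v0 ⊕E v1) ⊖E v1) (((a ▷₁ x₁) ⋄ʷ[ one ] mon ε) ∷ ((a ▷₁ y₁) ⋄ʷ[ one ] mon ε) ∷ []) [] ⟩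
    (a ▷₁ x₁) ⋄ʷ[ one ] mon ε ⊕ (a ▷₁ y₁) ⋄ʷ[ one ] mon ε ⊖ (a ▷₁ y₁) ⋄ʷ[ one ] mon ε
                                                                       ≈⟨ ⊖-cong (≃-trans (WordDiamond.⋄ʷ-zˡ one a (mon ε)) (▶z-cong (⋄ʷ-ε a))) (⋄ʷ-ε-▷y a (⋄ʷ-ε a)) ⟩
    mon (ιW a) ▶z ⊖ mon (ιW a) ▶ y one                                 ≈⟨ solveₑ ((v0 ▷E 0 ⊕E v0 ▷E 1) ⊖E v0 ▷E 1) (v0 ▷E 0) (mon (ιW a) ∷ []) (x ∷ y one ∷ []) ⟩
    mon (ιW (a ▷₁ x₁))                                                 ∎
    where open SetoidReasoning ≃-setoid

  ⋆-identityʳ : ∀ p → p ⋆ mon₁ ε₁ ≃₁ p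
  ⋆-identityʳ p = ≃₁-trans (ρ-cong (≃-trans (extend₁-ext p ⋄ʷ-ε) (≃-sym (ι≃extend₁ p)))) (≡⇒≃₁ (ρ-ι p))

  ⋆-zˡ : ∀ p q → (p ▶₁z) ⋆ q ≃₁ p ⋆ q ▶₁z
  ⋆-zˡ p q = ≃₁-trans (ρ-cong (⋄-zˡ p (ι q))) (≡⇒≃₁ (ρ-▶z (p ⋄[ one ] ι q)))

  ⋆-zʳ : ∀ p q → p ⋆ (q ▶₁z) ≃₁ p ⋆ q ▶₁z
  ⋆-zʳ p q = ≃₁-trans (≡⇒≃₁ (cong (λ U → ρ (p ⋄[ one ] U)) (ι-▶z q)))
             (≃₁-trans (ρ-cong (⋄-zʳ p (ι q))) (≡⇒≃₁ (ρ-▶z (p ⋄[ one ] ι q))))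

  ⋆-y-y : ∀ p q → (p ▶₁ y₁) ⋆ (q ▶₁ y₁) ≃₁
    ((p ⋆ (q ▶₁ y₁) ▶₁ y₁ ++ ⊝₁ (p ⋆ q ▶₁ x₁ ▶₁ y₁)) ++ ⊝₁ (p ⋆ q ▶₁ y₁ ▶₁ y₁)) ++ (p ▶₁ y₁) ⋆ q ▶₁ y₁
  ⋆-y-y p q = ≃₁-trans (≡⇒≃₁ (cong (λ U → ρ ((p ▶₁ y₁) ⋄[ one ] U)) (ι-▶ q y₁)))
              (≃₁-trans (ρ-cong (⋄-y-y p (ι q))) (≡⇒≃₁ (trans ρ-expand
                (cong (λ U → ((ρ (p ⋄[ one ] U) ▶₁ y₁ ++ ⊝₁ (p ⋆ q ▶₁ x₁ ▶₁ y₁)) ++ ⊝₁ (p ⋆ q ▶₁ y₁ ▶₁ y₁)) ++ (p ▶₁ y₁) ⋆ q ▶₁ y₁)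
                      (sym (ι-▶ q y₁))))))
    where
    A = p ⋄[ one ] (ι q ▶ y one)
    B = p ⋄[ one ] ι q
    C = (p ▶₁ y₁) ⋄[ one ] ι q
    ρ-expand : ρ (A ▶ y one ⊖ B ▶ x ▶ y one ⊖ B ▶ y one ▶ y one ⊕ C ▶ y one) ≡
               ((ρ A ▶₁ y₁ ++ ⊝₁ (ρ B ▶₁ x₁ ▶₁ y₁)) ++ ⊝₁ (ρ B ▶₁ y₁ ▶₁ y₁)) ++ ρ C ▶₁ y₁
    ρ-expand rewrite ρ-++ (A ▶ y one ⊖ B ▶ x ▶ y one ⊖ B ▶ y one ▶ y one) (C ▶ y one)
               | ρ-++ (A ▶ y one ⊖ B ▶ x ▶ y one) (⊝ (B ▶ y one ▶ y one))
               | ρ-++ (A ▶ y one) (⊝ (B ▶ x ▶ y one))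
               | ρ-⊛ (- 1ℚ) (B ▶ x ▶ y one) | ρ-⊛ (- 1ℚ) (B ▶ y one ▶ y one)
               | ρ-▶ A y₁ | ρ-▶ C y₁ | ρ-▶ (B ▶ x) y₁ | ρ-▶ (B ▶ y one) y₁ | ρ-▶ B x₁ | ρ-▶ B y₁ = refl

  ⋆-congˡ : ∀ {p p′} q → p ≃₁ p′ → p ⋆ q ≃₁ p′ ⋆ q
  ⋆-congˡ q e = ρ-cong (⋄-congˡ (ι q) e)

  ⋆-congʳ : ∀ p {q q′} → q ≃₁ q′ → p ⋆ q ≃₁ p ⋆ q′
  ⋆-congʳ p e = ρ-cong (⋄-congʳ p (ι-cong e))

  ⋆-++ˡ : ∀ p p′ q → (p ++ p′) ⋆ q ≃₁ p ⋆ q ++ p′ ⋆ q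
  ⋆-++ˡ p p′ q = ≃₁-trans (ρ-cong (⋄-++ˡ p p′ (ι q))) (≡⇒≃₁ (ρ-++ (p ⋄[ one ] ι q) (p′ ⋄[ one ] ι q)))

  ⋆-++ʳ : ∀ p q q′ → p ⋆ (q ++ q′) ≃₁ p ⋆ q ++ p ⋆ q′
  ⋆-++ʳ p q q′ = ≃₁-trans (≡⇒≃₁ (cong (λ U → ρ (p ⋄[ one ] U)) (ι-++ q q′)))
    (≃₁-trans (ρ-cong (⋄-⊕ʳ p (ι q) (ι q′))) (≡⇒≃₁ (ρ-++ (p ⋄[ one ] ι q) (p ⋄[ one ] ι q′))))

  ⋆-scaleˡ : ∀ c p q → Sums₁.scale c p ⋆ q ≃₁ Sums₁.scale c (p ⋆ q)
  ⋆-scaleˡ c p q = ≃₁-trans (ρ-cong (⋄-scaleˡ c p (ι q))) (≡⇒≃₁ (ρ-⊛ c (p ⋄[ one ] ι q)))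

  ⋆-scaleʳ : ∀ c p q → p ⋆ Sums₁.scale c q ≃₁ Sums₁.scale c (p ⋆ q)
  ⋆-scaleʳ c p q = ≃₁-trans (≡⇒≃₁ (cong (λ U → ρ (p ⋄[ one ] U)) (ι-scale c q)))
    (≃₁-trans (ρ-cong (⋄-⊛ʳ p c (ι q))) (≡⇒≃₁ (ρ-⊛ c (p ⋄[ one ] ι q))))

  ⋆-nilʳ : ∀ p → p ⋆ [] ≃₁ []
  ⋆-nilʳ p = ρ-cong (⋄-nilʳ p)

-- Associativity

module Associativity {n : ℕ} (s : Root n) where
  open Product₁ n
  open PolyDiamond s

  Assoc : Poly n → Poly₁ → Poly₁ → Set
  Assoc W p q = (p ⋆ q) ⋄[ s ] W ≃ p ⋄[ s ] (q ⋄[ s ] W)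

  module _ (W : Poly n) where

    assoc-congˡ : ∀ {p p′} q → p ≃₁ p′ → Assoc W p q → Assoc W p′ q
    assoc-congˡ q e h = ≃-trans (⋄-congˡ W (⋆-congˡ q (≃₁-sym e))) (≃-trans h (⋄-congˡ (q ⋄[ s ] W) e))

    assoc-congʳ : ∀ p {q q′} → q ≃₁ q′ → Assoc W p q → Assoc W p q′
    assoc-congʳ p e h = ≃-trans (⋄-congˡ W (⋆-congʳ p (≃₁-sym e))) (≃-trans h (⋄-congʳ p (⋄-congˡ W e)))

    assoc-++ˡ : ∀ p p′ q → Assoc W p q → Assoc W p′ q → Assoc W (p ++ p′) q
    assoc-++ˡ p p′ q h h′ = ≃-trans (⋄-congˡ W (⋆-++ˡ p p′ q))
      (≃-trans (⋄-++ˡ (p ⋆ q) (p′ ⋆ q) W) (≃-trans (⊕-cong h h′) (≃-sym (⋄-++ˡ p p′ (q ⋄[ s ] W)))))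

    assoc-++ʳ : ∀ p q q′ → Assoc W p q → Assoc W p q′ → Assoc W p (q ++ q′)
    assoc-++ʳ p q q′ h h′ = ≃-trans (⋄-congˡ W (⋆-++ʳ p q q′))
      (≃-trans (⋄-++ˡ (p ⋆ q) (p ⋆ q′) W) (≃-trans (⊕-cong h h′)
        (≃-sym (≃-trans (⋄-congʳ p (⋄-++ˡ q q′ W)) (⋄-⊕ʳ p (q ⋄[ s ] W) (q′ ⋄[ s ] W))))))

    assoc-scaleˡ : ∀ c p q → Assoc W p q → Assoc W (Sums₁.scale c p) q
    assoc-scaleˡ c p q h = ≃-trans (⋄-congˡ W (⋆-scaleˡ c p q))
      (≃-trans (⋄-scaleˡ c (p ⋆ q) W) (≃-trans (⊛-cong c h) (≃-sym (⋄-scaleˡ c p (q ⋄[ s ] W)))))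

    assoc-scaleʳ : ∀ c p q → Assoc W p q → Assoc W p (Sums₁.scale c q)
    assoc-scaleʳ c p q h = ≃-trans (⋄-congˡ W (⋆-scaleʳ c p q))
      (≃-trans (⋄-scaleˡ c (p ⋆ q) W) (≃-trans (⊛-cong c h)
        (≃-sym (≃-trans (⋄-congʳ p (⋄-scaleˡ c q W)) (⋄-⊛ʳ p c (q ⋄[ s ] W))))))

    assoc-monomialsˡ : ∀ q → (∀ a → Assoc W (mon₁ a) q) → ∀ p → Assoc W p q
    assoc-monomialsˡ q h []            = ≃-refl
    assoc-monomialsˡ q h ((c , a) ∷ p) = assoc-congˡ q (≃₁-sym (cons≃scale-mon₁ c a p))
      (assoc-++ˡ (Sums₁.scale c (mon₁ a)) p q (assoc-scaleˡ c (mon₁ a) q (h a)) (assoc-monomialsˡ q h p))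

    assoc-monomialsʳ : ∀ p → (∀ b → Assoc W p (mon₁ b)) → ∀ q → Assoc W p q
    assoc-monomialsʳ p h []            = ≃-trans (⋄-congˡ W (⋆-nilʳ p)) (≃-sym (⋄-nilʳ p))
    assoc-monomialsʳ p h ((c , b) ∷ q) = assoc-congʳ p (≃₁-sym (cons≃scale-mon₁ c b q))
      (assoc-++ʳ p (Sums₁.scale c (mon₁ b)) q (assoc-scaleʳ c p (mon₁ b) (h b)) (assoc-monomialsʳ p h q))

    -- The only case of the double induction on words that depends on W.
    YYStep : Set
    YYStep = ∀ a b → (∀ q → Assoc W (mon₁ a) q) → Assoc W (mon₁ (a ▷₁ y₁)) (mon₁ b) →
             Assoc W (mon₁ (a ▷₁ y₁)) (mon₁ (b ▷₁ y₁))

    assoc-from-YYStep : YYStep → ∀ p q → Assoc W p q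
    assoc-from-YYStep yy p q = assoc-monomialsˡ q (λ a → assoc-mon a q) p
      where
      ε-case : ∀ q → Assoc W (mon₁ ε₁) q
      ε-case q = ≃-trans (⋄-congˡ W (⋆-identityˡ q)) (≃-sym (⋄-identityˡ (q ⋄[ s ] W)))

      z-case : ∀ a → (∀ q → Assoc W (mon₁ a) q) → ∀ q → Assoc W (mon₁ a ▶₁z) q
      z-case a h q = ≃-trans (⋄-congˡ W (⋆-zˡ (mon₁ a) q))
        (≃-trans (⋄-zˡ (mon₁ a ⋆ q) W) (≃-trans (▶z-cong (h q)) (≃-sym (⋄-zˡ (mon₁ a) (q ⋄[ s ] W)))))

      y-case : ∀ a → (∀ q → Assoc W (mon₁ a) q) → ∀ b → Assoc W (mon₁ (a ▷₁ y₁)) (mon₁ b)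
      y-case a h = word-induction (Assoc W ay) (assoc-congʳ ay) (λ {q} {q′} → assoc-++ʳ ay q q′)
        (λ c {q} → assoc-scaleʳ c ay q)
        (≃-trans (⋄-congˡ W (⋆-identityʳ ay)) (≃-sym (⋄-congʳ ay (⋄-identityˡ W))))
        (λ b hb → ≃-trans (⋄-congˡ W (⋆-zʳ ay (mon₁ b)))
          (≃-trans (⋄-zˡ (ay ⋆ mon₁ b) W) (≃-trans (▶z-cong hb)
          (≃-trans (≃-sym (⋄-zʳ ay (mon₁ b ⋄[ s ] W))) (⋄-congʳ ay (≃-sym (⋄-zˡ (mon₁ b) W)))))))
        (λ b hb → yy a b h hb)
        where ay = mon₁ (a ▷₁ y₁)

      assoc-mon : ∀ a q → Assoc W (mon₁ a) q
      assoc-mon = word-induction (λ p → ∀ q → Assoc W p q) (λ e h q → assoc-congˡ q e (h q)) (λ {p} {p′} h h′ q → assoc-++ˡ p p′ q (h q) (h′ q))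
        (λ c {p} h q → assoc-scaleˡ c p q (h q)) ε-case z-case
        (λ a h → assoc-monomialsʳ (mon₁ (a ▷₁ y₁)) (y-case a h))

  ⋄-⊖ʳ : ∀ p A B → p ⋄[ s ] (A ⊖ B) ≃ p ⋄[ s ] A ⊖ p ⋄[ s ] B
  ⋄-⊖ʳ p A B = ≃-trans (⋄-⊕ʳ p A (⊝ B)) (⊕-cong ≃-refl (⋄-⊝ʳ p B))

  ⋄-⊖⊕ʳ : ∀ p A B C → p ⋄[ s ] (A ⊖ B ⊕ C) ≃ p ⋄[ s ] A ⊖ p ⋄[ s ] B ⊕ p ⋄[ s ] C
  ⋄-⊖⊕ʳ p A B C = ≃-trans (⋄-⊕ʳ p (A ⊖ B) C) (⊕-cong (⋄-⊖ʳ p A B) ≃-refl)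

  ⋄-⊖⊖⊕ʳ : ∀ p A B C D → p ⋄[ s ] (A ⊖ B ⊖ C ⊕ D) ≃ p ⋄[ s ] A ⊖ p ⋄[ s ] B ⊖ p ⋄[ s ] C ⊕ p ⋄[ s ] D
  ⋄-⊖⊖⊕ʳ p A B C D = ≃-trans (⋄-⊕ʳ p (A ⊖ B ⊖ C) D) (⊕-cong (≃-trans (⋄-⊖ʳ p (A ⊖ B) C) (⊖-cong (⋄-⊖ʳ p A B) ≃-refl)) ≃-refl)

  ⋄-zˡ-split : ∀ r W → (r ▶₁ x₁) ⋄[ s ] W ⊕ (r ▶₁ y₁) ⋄[ s ] W ≃ r ⋄[ s ] W ▶z
  ⋄-zˡ-split r W = ≃-trans (≃-sym (⋄-++ˡ (r ▶₁ x₁) (r ▶₁ y₁) W)) (⋄-zˡ r W)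

  ⋄-zʳ-split : ∀ r U → r ⋄[ s ] (U ▶ x) ⊕ r ⋄[ s ] (U ▶ y one) ≃ r ⋄[ s ] U ▶z
  ⋄-zʳ-split r U = ≃-trans (≃-sym (⋄-⊕ʳ r (U ▶ x) (U ▶ y one))) (⋄-zʳ r U)

  -- In each case W = P y, P z_t, 1 of the step (a y, b y) both sides are expanded by the
  -- recursion laws until only the induction hypotheses separate them.
  module YYCase (a b : Word₁) where
    A′ = mon₁ a
    B′ = mon₁ b
    ay = mon₁ (a ▷₁ y₁)
    by = mon₁ (b ▷₁ y₁)
    R₁ = A′ ⋆ by
    R₂ = A′ ⋆ B′
    R₃ = ay ⋆ B′

    ⋆-y-y-⋄ : ∀ W → (ay ⋆ by) ⋄[ s ] W ≃
      (R₁ ▶₁ y₁) ⋄[ s ] W ⊖ (R₂ ▶₁ x₁ ▶₁ y₁) ⋄[ s ] W ⊖ (R₂ ▶₁ y₁ ▶₁ y₁) ⋄[ s ] W ⊕ (R₃ ▶₁ y₁) ⋄[ s ] W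
    ⋆-y-y-⋄ W = ≃-trans (⋄-congˡ W (⋆-y-y A′ B′))
      (≃-trans (⋄-++ˡ ((R₁ ▶₁ y₁ ++ ⊝₁ (R₂ ▶₁ x₁ ▶₁ y₁)) ++ ⊝₁ (R₂ ▶₁ y₁ ▶₁ y₁)) (R₃ ▶₁ y₁) W)
      (⊕-cong (≃-trans (⋄-++ˡ (R₁ ▶₁ y₁ ++ ⊝₁ (R₂ ▶₁ x₁ ▶₁ y₁)) (⊝₁ (R₂ ▶₁ y₁ ▶₁ y₁)) W)
        (⊕-cong (≃-trans (⋄-++ˡ (R₁ ▶₁ y₁) (⊝₁ (R₂ ▶₁ x₁ ▶₁ y₁)) W) (⊕-cong ≃-refl (⋄-scaleˡ (- 1ℚ) (R₂ ▶₁ x₁ ▶₁ y₁) W)))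
                (⋄-scaleˡ (- 1ℚ) (R₂ ▶₁ y₁ ▶₁ y₁) W))) ≃-refl))

  YYStep-▶y : (P : Poly n) → (∀ p q → Assoc P p q) → YYStep (P ▶ y one)
  YYStep-▶y P assocP a b outer inner =
    ≃-trans (⋆-y-y-⋄ Wy)
    (≃-trans (rewriteₑ e₀ es₀ τ₀ ℓ (⋄-y-y R₁ P ∷ ⋄-y-y (R₂ ▶₁ x₁) P ∷ ⋄-y-y (R₂ ▶₁ y₁) P ∷ ⋄-y-y R₃ P ∷ []))
    (≃-trans (solveₑ (substitute e₀ es₀) e₁ τ₀ ℓ)
    (≃-trans (rewriteₑ e₁′ es₁ τ₂ ℓ
       (outer by ∷ ≃-trans (⋄-zˡ-split R₂ Wy) (▶z-cong (outer B′)) ∷ inner ∷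
        assocP A′ by ∷ ≃-trans (⋄-zˡ-split R₂ P) (▶z-cong (assocP A′ B′)) ∷ assocP ay B′ ∷
        ≃-trans (≃-sym (⋆-y-y-⋄ P)) (assocP ay by) ∷ []))
    (≃-trans (solveₑ (substitute e₁′ es₁) (substitute eᵣ′ esᵣ) τ₂ ℓ)
    (≃-sym
    (≃-trans (⋄-congʳ ay (⋄-y-y B′ P))
    (≃-trans (⋄-⊖⊖⊕ʳ ay (K₁ ▶ y one) (K₂ ▶ x ▶ y one) (K₂ ▶ y one ▶ y one) (K₃ ▶ y one))
    (≃-trans (rewriteₑ e₀ es₀ τᵣ ℓ (⋄-y-y A′ K₁ ∷ ⋄-y-y A′ (K₂ ▶ x) ∷ ⋄-y-y A′ (K₂ ▶ y one) ∷ ⋄-y-y A′ K₃ ∷ []))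
    (≃-trans (solveₑ (substitute e₀ es₀) eᵣ τᵣ ℓ)
    (rewriteₑ eᵣ′ esᵣ τ₂ ℓ
       (≃-sym (≃-trans (⋄-congʳ A′ (⋄-y-y B′ P)) (⋄-⊖⊖⊕ʳ A′ (K₁ ▶ y one) (K₂ ▶ x ▶ y one) (K₂ ▶ y one ▶ y one) (K₃ ▶ y one)))
        ∷ ≃-refl ∷ ⋄-zʳ-split A′ K₂ ∷ ≃-refl ∷ ≃-refl ∷ ⋄-zʳ-split ay K₂ ∷ ≃-refl ∷ [])))))))))))
    where
    open YYCase a b
    Wy = P ▶ y one
    ℓ = x ∷ y one ∷ []
    y-yₑ : ℕ → Expr
    y-yₑ k = var k ▷E 1 ⊖E var (suc k) ▷E 0 ▷E 1 ⊖E var (suc k) ▷E 1 ▷E 1 ⊕E var (suc (suc k)) ▷E 1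
    zₑ : Expr → Expr
    zₑ e = e ▷E 0 ⊕E e ▷E 1
    e₀ = v0 ⊖E v1 ⊖E v2 ⊕E v3
    es₀ = y-yₑ 0 ∷ y-yₑ 3 ∷ y-yₑ 6 ∷ y-yₑ 9 ∷ []
    τ₀ = R₁ ⋄[ s ] Wy ∷ R₁ ⋄[ s ] P ∷ (R₁ ▶₁ y₁) ⋄[ s ] P ∷
         (R₂ ▶₁ x₁) ⋄[ s ] Wy ∷ (R₂ ▶₁ x₁) ⋄[ s ] P ∷ (R₂ ▶₁ x₁ ▶₁ y₁) ⋄[ s ] P ∷
         (R₂ ▶₁ y₁) ⋄[ s ] Wy ∷ (R₂ ▶₁ y₁) ⋄[ s ] P ∷ (R₂ ▶₁ y₁ ▶₁ y₁) ⋄[ s ] P ∷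
         R₃ ⋄[ s ] Wy ∷ R₃ ⋄[ s ] P ∷ (R₃ ▶₁ y₁) ⋄[ s ] P ∷ []
    e₁ = (v0 ⊖E (v3 ⊕E v6) ⊕E v9) ▷E 1 ⊖E (v1 ⊖E (v4 ⊕E v7) ⊕E var 10) ▷E 0 ▷E 1
         ⊖E (v1 ⊖E (v4 ⊕E v7) ⊕E var 10) ▷E 1 ▷E 1 ⊕E (v2 ⊖E v5 ⊖E v8 ⊕E var 11) ▷E 1
    e₁′ = (v0 ⊖E v1 ⊕E v2) ▷E 1 ⊖E (v3 ⊖E v4 ⊕E v5) ▷E 0 ▷E 1 ⊖E (v3 ⊖E v4 ⊕E v5) ▷E 1 ▷E 1 ⊕E v6 ▷E 1
    K₁ = B′ ⋄[ s ] Wy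
    K₂ = B′ ⋄[ s ] P
    K₃ = by ⋄[ s ] P
    τ₂ = A′ ⋄[ s ] (by ⋄[ s ] Wy) ∷ A′ ⋄[ s ] K₁ ∷ ay ⋄[ s ] K₁ ∷ A′ ⋄[ s ] K₃ ∷ A′ ⋄[ s ] K₂ ∷ ay ⋄[ s ] K₂ ∷ ay ⋄[ s ] K₃ ∷ []
    es₁ = v0 ∷ zₑ v1 ∷ v2 ∷ v3 ∷ zₑ v4 ∷ v5 ∷ v6 ∷ []
    τᵣ = A′ ⋄[ s ] (K₁ ▶ y one) ∷ A′ ⋄[ s ] K₁ ∷ ay ⋄[ s ] K₁ ∷
         A′ ⋄[ s ] (K₂ ▶ x ▶ y one) ∷ A′ ⋄[ s ] (K₂ ▶ x) ∷ ay ⋄[ s ] (K₂ ▶ x) ∷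
         A′ ⋄[ s ] (K₂ ▶ y one ▶ y one) ∷ A′ ⋄[ s ] (K₂ ▶ y one) ∷ ay ⋄[ s ] (K₂ ▶ y one) ∷
         A′ ⋄[ s ] (K₃ ▶ y one) ∷ A′ ⋄[ s ] K₃ ∷ ay ⋄[ s ] K₃ ∷ []
    eᵣ = (v0 ⊖E v3 ⊖E v6 ⊕E v9) ▷E 1 ⊖E (v1 ⊖E (v4 ⊕E v7) ⊕E var 10) ▷E 0 ▷E 1
         ⊖E (v1 ⊖E (v4 ⊕E v7) ⊕E var 10) ▷E 1 ▷E 1 ⊕E (v2 ⊖E (v5 ⊕E v8) ⊕E var 11) ▷E 1
    eᵣ′ = v0 ▷E 1 ⊖E (v1 ⊖E v2 ⊕E v3) ▷E 0 ▷E 1 ⊖E (v1 ⊖E v2 ⊕E v3) ▷E 1 ▷E 1 ⊕E (v4 ⊖E v5 ⊕E v6) ▷E 1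
    esᵣ = v0 ∷ v1 ∷ zₑ v4 ∷ v3 ∷ v2 ∷ zₑ v5 ∷ v6 ∷ []

  -- y − y_t = z − z_t
  ⋄-y-[y−yt] : ∀ a k Q → mon₁ (a ▷₁ y₁) ⋄[ s ] (Q ▶y−y[ fsuc k ]) ≃
    mon₁ (a ▷₁ y₁) ⋄[ s ] Q ▶z ⊖ ((mon₁ a ⋄[ s ] (Q ▶ x) ⊕ mon₁ a ⋄[ s ] (Q ▶ y (fsuc k))) ▶y−y[ fsuc k ]
                                    ⊕ mon₁ (a ▷₁ y₁) ⋄[ s ] Q ▶z[ fsuc k ])
  ⋄-y-[y−yt] a k Q =
    ≃-trans (⋄-congʳ ay (solveₑ (v0 ▷E 1 ⊖E v0 ▷E 2) ((v0 ▷E 0 ⊕E v0 ▷E 1) ⊖E (v0 ▷E 0 ⊕E v0 ▷E 2)) (Q ∷ []) (x ∷ y one ∷ y t ∷ [])))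
    (≃-trans (⋄-⊖ʳ ay (Q ▶z) (Q ▶z[ t ]))
    (⊖-cong (⋄-zʳ ay Q) (≃-trans (⋄-y-zt (mon₁ a) k Q)
      (⊕-cong (▶y−y-cong t (⋄-⊕ʳ (mon₁ a) (Q ▶ x) (Q ▶ y t))) ≃-refl))))
    where
    t = fsuc k
    ay = mon₁ (a ▷₁ y₁)

  YYStep-▶zt : (k : Fin n) (P : Poly n) → (∀ p q → Assoc P p q) → YYStep (P ▶z[ fsuc k ])
  YYStep-▶zt k P assocP a b outer inner =
    ≃-trans (⋆-y-y-⋄ W)
    (≃-trans (rewriteₑ e₀ es₀ τ₀ ℓ (⋄-y-zt R₁ k P ∷ ⋄-y-zt (R₂ ▶₁ x₁) k P ∷ ⋄-y-zt (R₂ ▶₁ y₁) k P ∷ ⋄-y-zt R₃ k P ∷ []))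
    (≃-trans (solveₑ (substitute e₀ es₀) e₁ τ₀ ℓ)
    (≃-trans (rewriteₑ e₁′ es₁ τ₂ ℓ
       (≃-trans (outer by) (≃-trans (⋄-congʳ A′ (⋄-y-zt B′ k P)) (⋄-⊖⊕ʳ A′ (K₁ ▶ y one) (K₁ ▶ y t) (K₃ ▶z[ t ]))) ∷
        ≃-trans (⋄-zˡ-split R₂ W) (≃-trans (▶z-cong (outer B′)) (≃-sym (⋄-zʳ-split A′ K₁))) ∷
        inner ∷
        ≃-trans (≃-sym (⋆-y-y-⋄ P)) (assocP ay by) ∷ []))
    (≃-trans (solveₑ (substitute e₁′ es₁) eᵣ τ₂ ℓ)
    (≃-sym
    (≃-trans (⋄-congʳ ay (⋄-y-zt B′ k P))
    (≃-trans (⋄-⊕ʳ ay (K₁ ▶y−y[ t ]) (K₃ ▶z[ t ]))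
    (⊕-cong (⋄-y-[y−yt] a k K₁) (⋄-y-zt A′ k K₃)))))))))
    where
    open YYCase a b
    t = fsuc k
    W = P ▶z[ t ]
    ℓ = x ∷ y one ∷ y t ∷ []
    y−ytₑ zₜₑ zₑ : Expr → Expr
    y−ytₑ e = e ▷E 1 ⊖E e ▷E 2
    zₜₑ e = e ▷E 0 ⊕E e ▷E 2
    zₑ e = e ▷E 0 ⊕E e ▷E 1
    y-ztₑ : ℕ → Expr
    y-ztₑ j = y−ytₑ (var j) ⊕E zₜₑ (var (suc j))
    e₀ = v0 ⊖E v1 ⊖E v2 ⊕E v3
    es₀ = y-ztₑ 0 ∷ y-ztₑ 2 ∷ y-ztₑ 4 ∷ y-ztₑ 6 ∷ []
    τ₀ = R₁ ⋄[ s ] W ∷ (R₁ ▶₁ y₁) ⋄[ s ] P ∷ (R₂ ▶₁ x₁) ⋄[ s ] W ∷ (R₂ ▶₁ x₁ ▶₁ y₁) ⋄[ s ] P ∷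
         (R₂ ▶₁ y₁) ⋄[ s ] W ∷ (R₂ ▶₁ y₁ ▶₁ y₁) ⋄[ s ] P ∷ R₃ ⋄[ s ] W ∷ (R₃ ▶₁ y₁) ⋄[ s ] P ∷ []
    e₁ = y−ytₑ (v0 ⊖E (v2 ⊕E v4) ⊕E v6) ⊕E zₜₑ (v1 ⊖E v3 ⊖E v5 ⊕E v7)
    e₁′ = y−ytₑ (v0 ⊖E v1 ⊕E v2) ⊕E zₜₑ v3
    K₁ = B′ ⋄[ s ] W
    K₃ = by ⋄[ s ] P
    τ₂ = A′ ⋄[ s ] (K₁ ▶ y one) ∷ A′ ⋄[ s ] (K₁ ▶ y t) ∷ A′ ⋄[ s ] (K₃ ▶z[ t ]) ∷ A′ ⋄[ s ] (K₁ ▶ x) ∷ ay ⋄[ s ] K₁ ∷ ay ⋄[ s ] K₃ ∷ []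
    es₁ = (v0 ⊖E v1 ⊕E v2) ∷ (v3 ⊕E v0) ∷ v4 ∷ v5 ∷ []
    eᵣ = (zₑ v4 ⊖E (y−ytₑ (v3 ⊕E v1) ⊕E zₜₑ v4)) ⊕E (y−ytₑ v2 ⊕E zₜₑ v5)

YYStep-ε : (s : Root n) → Associativity.YYStep s (mon ε)
YYStep-ε {n} fzero a b outer inner =
  ≃-trans (⋆-y-y-⋄ (mon ε))
  (≃-trans (rewriteₑ e₀ es₀ τ₀ ℓ (⋄-y-ε R₁ ∷ ⋄-y-ε (R₂ ▶₁ x₁) ∷ ⋄-y-ε (R₂ ▶₁ y₁) ∷ ⋄-y-ε R₃ ∷ []))
  (≃-trans (solveₑ (substitute e₀ es₀) e₁ τ₀ ℓ)
  (≃-trans (rewriteₑ e₁′ es₁ τ₂ ℓ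
     (≃-trans (outer by) (⋄-congʳ A′ by⋄ε) ∷
      ≃-trans (⋄-zˡ-split R₂ (mon ε)) (▶z-cong (outer B′)) ∷
      inner ∷ []))
  (≃-trans (solveₑ (substitute e₁′ es₁) eᵣ τ₂ ℓ)
  (≃-sym (≃-trans (⋄-congʳ ay by⋄ε) (⋄-y-y A′ K)))))))
  where
  open Product₁ n
  open PolyDiamond {n} fzero
  open Associativity {n} fzero
  open YYCase a b
  ℓ = x ∷ y one ∷ []
  y-εₑ : ℕ → Expr
  y-εₑ j = ⊝E (⊝E (var j ▷E 1))
  e₀ = v0 ⊖E v1 ⊖E v2 ⊕E v3
  es₀ = y-εₑ 0 ∷ y-εₑ 1 ∷ y-εₑ 2 ∷ y-εₑ 3 ∷ []
  τ₀ = R₁ ⋄[ fzero ] mon ε ∷ (R₂ ▶₁ x₁) ⋄[ fzero ] mon ε ∷ (R₂ ▶₁ y₁) ⋄[ fzero ] mon ε ∷ R₃ ⋄[ fzero ] mon ε ∷ []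
  e₁ = (v0 ⊖E (v1 ⊕E v2) ⊕E v3) ▷E 1
  e₁′ = (v0 ⊖E v1 ⊕E v2) ▷E 1
  K = B′ ⋄[ fzero ] mon ε
  by⋄ε : by ⋄[ fzero ] mon ε ≃ K ▶ y one
  by⋄ε = ≃-trans (⋄-y-ε B′) (solveₑ (⊝E (⊝E (v0 ▷E 1))) (v0 ▷E 1) (K ∷ []) ℓ)
  τ₂ = A′ ⋄[ fzero ] (K ▶ y one) ∷ A′ ⋄[ fzero ] K ∷ ay ⋄[ fzero ] K ∷ []
  es₁ = v0 ∷ (v1 ▷E 0 ⊕E v1 ▷E 1) ∷ v2 ∷ []
  eᵣ = v0 ▷E 1 ⊖E v1 ▷E 0 ▷E 1 ⊖E v1 ▷E 1 ▷E 1 ⊕E v2 ▷E 1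
YYStep-ε {n} (fsuc k) a b outer inner =
  ≃-trans (⋆-y-y-⋄ (mon ε))
  (≃-trans (rewriteₑ e₀ es₀ τ₀ ℓ (⋄-y-ε R₁ ∷ ⋄-y-ε (R₂ ▶₁ x₁) ∷ ⋄-y-ε (R₂ ▶₁ y₁) ∷ ⋄-y-ε R₃ ∷ []))
  (≃-trans (solveₑ (substitute e₀ es₀) e₁ τ₀ ℓ)
  (≃-trans (rewriteₑ e₁′ es₁ τ₂ ℓ
     (≃-trans (outer by) (≃-trans (⋄-congʳ A′ by⋄ε) (⋄-⊖ʳ A′ (K ▶ y one) (K ▶ y t))) ∷
      ≃-trans (⋄-zˡ-split R₂ (mon ε)) (≃-trans (▶z-cong (outer B′)) (≃-sym (⋄-zʳ-split A′ K))) ∷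
      inner ∷ []))
  (≃-trans (solveₑ (substitute e₁′ es₁) eᵣ τ₂ ℓ)
  (≃-sym (≃-trans (⋄-congʳ ay by⋄ε) (⋄-y-[y−yt] a k K)))))))
  where
  t = fsuc k
  open Product₁ n
  open PolyDiamond {n} t
  open Associativity {n} t
  open YYCase a b
  ℓ = x ∷ y one ∷ y t ∷ []
  y−ytₑ zₜₑ zₑ : Expr → Expr
  y−ytₑ e = e ▷E 1 ⊖E e ▷E 2
  zₜₑ e = e ▷E 0 ⊕E e ▷E 2
  zₑ e = e ▷E 0 ⊕E e ▷E 1
  y-εₑ : ℕ → Expr
  y-εₑ j = ⊝E (var j ▷E 2 ⊖E var j ▷E 1)
  e₀ = v0 ⊖E v1 ⊖E v2 ⊕E v3
  es₀ = y-εₑ 0 ∷ y-εₑ 1 ∷ y-εₑ 2 ∷ y-εₑ 3 ∷ []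
  τ₀ = R₁ ⋄[ t ] mon ε ∷ (R₂ ▶₁ x₁) ⋄[ t ] mon ε ∷ (R₂ ▶₁ y₁) ⋄[ t ] mon ε ∷ R₃ ⋄[ t ] mon ε ∷ []
  e₁ = y−ytₑ (v0 ⊖E (v1 ⊕E v2) ⊕E v3)
  e₁′ = y−ytₑ (v0 ⊖E v1 ⊕E v2)
  K = B′ ⋄[ t ] mon ε
  by⋄ε : by ⋄[ t ] mon ε ≃ K ▶ y one ⊖ K ▶ y t
  by⋄ε = ≃-trans (⋄-y-ε B′) (solveₑ (⊝E (v0 ▷E 2 ⊖E v0 ▷E 1)) (v0 ▷E 1 ⊖E v0 ▷E 2) (K ∷ []) ℓ)
  τ₂ = A′ ⋄[ t ] (K ▶ y one) ∷ A′ ⋄[ t ] (K ▶ y t) ∷ A′ ⋄[ t ] (K ▶ x) ∷ ay ⋄[ t ] K ∷ []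
  es₁ = (v0 ⊖E v1) ∷ (v2 ⊕E v0) ∷ v3 ∷ []
  eᵣ = zₑ v3 ⊖E (y−ytₑ (v2 ⊕E v1) ⊕E zₜₑ v3)

module AssociativityInW {n : ℕ} (s : Root n) where
  open Product₁ n
  open PolyDiamond s
  open Associativity s

  AssocAll : Poly n → Set
  AssocAll W = ∀ p q → Assoc W p q

  assocAll-cong : ∀ {W W′} → W ≃ W′ → AssocAll W → AssocAll W′
  assocAll-cong e h p q = ≃-trans (⋄-congʳ (p ⋆ q) (≃-sym e)) (≃-trans (h p q) (⋄-congʳ p (⋄-congʳ q e)))

  assocAll-⊕ : ∀ {W W′} → AssocAll W → AssocAll W′ → AssocAll (W ⊕ W′)
  assocAll-⊕ {W} {W′} h h′ p q = ≃-trans (⋄-⊕ʳ (p ⋆ q) W W′) (≃-trans (⊕-cong (h p q) (h′ p q))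
    (≃-sym (≃-trans (⋄-congʳ p (⋄-⊕ʳ q W W′)) (⋄-⊕ʳ p (q ⋄[ s ] W) (q ⋄[ s ] W′)))))

  assocAll-⊛ : ∀ c {W} → AssocAll W → AssocAll (c ⊛ W)
  assocAll-⊛ c {W} h p q = ≃-trans (⋄-⊛ʳ (p ⋆ q) c W) (≃-trans (⊛-cong c (h p q))
    (≃-sym (≃-trans (⋄-congʳ p (⋄-⊛ʳ q c W)) (⋄-⊛ʳ p c (q ⋄[ s ] W)))))

  assocAll-nil : AssocAll []
  assocAll-nil p q = ≃-trans (⋄-nilʳ (p ⋆ q)) (≃-sym (≃-trans (⋄-congʳ p (⋄-nilʳ q)) (⋄-nilʳ p)))

  assocAll-▶z : ∀ {P} → AssocAll P → AssocAll (P ▶z)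
  assocAll-▶z {P} h p q = ≃-trans (⋄-zʳ (p ⋆ q) P) (≃-trans (▶z-cong (h p q))
    (≃-trans (≃-sym (⋄-zʳ p (q ⋄[ s ] P))) (⋄-congʳ p (≃-sym (⋄-zʳ q P)))))

  assocAll-▶y : ∀ {P} → AssocAll P → AssocAll (P ▶ y one)
  assocAll-▶y {P} h = assoc-from-YYStep (P ▶ y one) (YYStep-▶y P h)

  assocAll-▶x : ∀ w → AssocAll (mon w) → AssocAll (mon (w ▷ x))
  assocAll-▶x w h = assocAll-cong {mon w ▶z ⊖ mon w ▶ y one}
    (solveₑ ((v0 ▷E 0 ⊕E v0 ▷E 1) ⊖E v0 ▷E 1) (v0 ▷E 0) (mon w ∷ []) (x ∷ y one ∷ []))
    (assocAll-⊕ {mon w ▶z} {⊝ (mon w ▶ y one)} (assocAll-▶z {mon w} h) (assocAll-⊛ (- 1ℚ) {mon w ▶ y one} (assocAll-▶y {mon w} h)))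

  assocAll-mon : ∀ w → AssocAll (mon w)
  assocAll-mon ε                = assoc-from-YYStep (mon ε) (YYStep-ε s)
  assocAll-mon (w ▷ x)          = assocAll-▶x w (assocAll-mon w)
  assocAll-mon (w ▷ y fzero)    = assocAll-▶y {mon w} (assocAll-mon w)
  assocAll-mon (w ▷ y (fsuc k)) = assocAll-cong {mon w ▶z[ fsuc k ] ⊖ mon (w ▷ x)}
    (solveₑ ((v0 ▷E 0 ⊕E v0 ▷E 1) ⊖E v0 ▷E 0) (v0 ▷E 1) (mon w ∷ []) (x ∷ y (fsuc k) ∷ []))
    (assocAll-⊕ {mon w ▶z[ fsuc k ]} {⊝ mon (w ▷ x)} (assoc-from-YYStep (mon w ▶z[ fsuc k ]) (YYStep-▶zt k (mon w) (assocAll-mon w)))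
                (assocAll-⊛ (- 1ℚ) {mon (w ▷ x)} (assocAll-▶x w (assocAll-mon w))))

  assocAll : ∀ W → AssocAll W
  assocAll W = assocAll-cong {extend mon W} (extend-mon W) (go W)
    where
    go : ∀ W → AssocAll (extend mon W)
    go []            = assocAll-nil
    go ((c , w) ∷ W) = assocAll-⊕ {c ⊛ mon w} {extend mon W} (assocAll-⊛ c {mon w} (assocAll-mon w)) (go W)

⋄≃⋄[] : (s : Root n) (p : Poly₁) (W : Poly n) → ⋄ s p W ≃ p ⋄[ s ] W
⋄≃⋄[] s p W = ≃-trans (≡⇒≃ (lin₁≡extend _ p)) (extend₁-ext p (λ a → ≡⇒≃ (lin≡extend (⋄W s a) W)))

lemma5p5 : (n : ℕ) (s : Root n) (u v : Poly₁) (w : Poly n)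
    → ⋄ s (⋄₁ n u v) w ≈ ⋄ s u (⋄ s v w)
lemma5p5 n s u v w w′ = begin
  coeff (⋄ s (⋄₁ n u v) w) w′       ≡⟨ coeff≡coeffOf (⋄ s (⋄₁ n u v) w) w′ ⟩
  coeffOf (⋄ s (⋄₁ n u v) w) w′     ≡⟨ at assoc w′ ⟩
  coeffOf (⋄ s u (⋄ s v w)) w′      ≡⟨ sym (coeff≡coeffOf (⋄ s u (⋄ s v w)) w′) ⟩
  coeff (⋄ s u (⋄ s v w)) w′        ∎
  where
  open ≡-Reasoning
  open Product₁ n
  open PolyDiamond s
  assoc : ⋄ s (⋄₁ n u v) w ≃ ⋄ s u (⋄ s v w)
  assoc = SR.begin
    ⋄ s (⋄₁ n u v) w            SR.≈⟨ ⋄≃⋄[] s (⋄₁ n u v) w ⟩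
    ⋄₁ n u v ⋄[ s ] w           SR.≈⟨ ⋄-congˡ w (ρ-cong (⋄≃⋄[] one u (ι v))) ⟩
    (u ⋆ v) ⋄[ s ] w            SR.≈⟨ AssociativityInW.assocAll s w u v ⟩
    u ⋄[ s ] (v ⋄[ s ] w)       SR.≈⟨ ⋄-congʳ u (≃-sym (⋄≃⋄[] s v w)) ⟩
    u ⋄[ s ] (⋄ s v w)          SR.≈⟨ ≃-sym (⋄≃⋄[] s u (⋄ s v w)) ⟩
    ⋄ s u (⋄ s v w)             SR.∎
    where module SR = SetoidReasoning ≃-setoid
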